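{- For every integer $n\geq 1$, the number of spanning quasi-trees of the bouquet $\mathbb{F}^{1}_n$ is the $(n+2)$-th Fibonacci number: $\kappa(\mathbb{F}^{1}_n)=f_{n+2}$.
   Context: A bouquet is a ribbon graph (surface with boundary made of vertex discs and edge ribbons) with exactly one vertex. A quasi-tree is a ribbon graph with exactly one boundary component; $\kappa(G)$ is the number of $F\subseteq E(G)$ such that the spanning ribbon subgraph $(V(G),F)$ (delete edges outside $F$) is a quasi-tree. A bouquet with edges $1,\dots,n$ is given by a signed rotation: a cyclic sequence in which each label occurs twice, recording the order in which the edge ends meet the vertex boundary; occurrences may carry a minus sign (plus omitted), and edge $i$ is an orientable loop iff its two occurrences have the same sign, non-orientable (forming a Möbius band with the vertex) otherwise. $\mathbb{F}_n$ has signed rotation $1$, followed by $i,i-1$ for $i=2,\dots,n$, followed by $n$, i.e. $(1,2,1,3,2,4,3,\dots,n,n-1,n)$ (so $\mathbb{F}_1=(1,1)$). $\mathbb{F}^{1}_n$ is obtained by adding a half-twist to edge $1$: signed rotation $(-1,2,1,3,2,\dots,n,n-1,n)$, with $\mathbb{F}^1_1=(-1,1)$. Fibonacci numbers: $f_1=f_2=1$, $f_k=f_{k-1}+f_{k-2}$. -}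

module Defs where

open import Data.Bool using (Bool; true; false; not; _∧_; _∨_; _xor_; if_then_else_)
open import Data.Nat using (ℕ; zero; suc; _+_; _*_; _≡ᵇ_; _<ᵇ_)
open import Data.Nat.DivMod using (_%_)
open import Data.Fin using (Fin; toℕ; inject₁; fromℕ) renaming (zero to fzero; suc to fsuc)
open import Data.Fin.Subset using (Subset)
open import Data.Vec using (Vec; []; _∷_; lookup)
open import Data.List using (List; []; _∷_; _++_; [_]; map; concat; concatMap;
  filterᵇ; length; upTo; allFin; zip)
open import Data.Bool.ListAction using (any)
open import Data.Product using (_×_; _,_; proj₁; proj₂)

-- Signed rotations of bouquets with edge set Fin n.
-- An occurrence is (sign , edge label); sign true = '+', false = '-'.
SignedRotation : ℕ → Set
SignedRotation n = List (Bool × Fin n)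

-- Occurrence p (0-based position in the cyclic sequence, length L) is an
-- arc on the vertex boundary with two end points: its left end 2p and its
-- right end 2p+1 (in the cyclic order).  The boundary of the ribbon graph
-- is the 2-regular graph on these 2L points with
--   * vertex-boundary arcs (corners):  2p+1 — 2((p+1) mod L)
--   * ribbon sides for the two ends p < q of an edge:
--       untwisted (equal signs):   2p+1 — 2q   and  2q+1 — 2p
--       twisted (different signs): 2p+1 — 2q+1 and  2p   — 2q
-- The number of boundary components is the number of connected
-- components of this graph (and 1 for the bare vertex disc, L = 0).

Edge : Set
Edge = ℕ × ℕ

cornerEdges : ℕ → List Edge
cornerEdges L = map (λ p → (2 * p + 1 , 2 * ((p + 1) % suc (L Data.Nat.∸ 1)))) (upTo L)
  where import Data.Nat

ribbonEdges : ∀ {n} → List (ℕ × (Bool × Fin n)) → List Edge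
ribbonEdges [] = []
ribbonEdges ((p , (s , e)) ∷ rest) =
  concatMap side rest ++ ribbonEdges rest
  where
  side : ℕ × (Bool × Fin _) → List Edge
  side (q , (s' , e')) =
    if toℕ e ≡ᵇ toℕ e'
    then (if not (s xor s')
          then (2 * p + 1 , 2 * q) ∷ (2 * q + 1 , 2 * p) ∷ []
          else (2 * p + 1 , 2 * q + 1) ∷ (2 * p , 2 * q) ∷ [])
    else []

boundaryEdges : ∀ {n} → SignedRotation n → List Edge
boundaryEdges r =
  cornerEdges (length r) ++ ribbonEdges (zip (upTo (length r)) r)

memᵇ : ℕ → List ℕ → Bool
memᵇ a c = any (λ x → x ≡ᵇ a) c

addEdge : Edge → List (List ℕ) → List (List ℕ)
addEdge (a , b) cs =
  concat (filterᵇ touches cs) ∷ filterᵇ (λ c → not (touches c)) cs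
  where
  touches : List ℕ → Bool
  touches c = memᵇ a c ∨ memᵇ b c

components : ℕ → List Edge → List (List ℕ)
components N es = go es (map [_] (upTo N))
  where
  go : List Edge → List (List ℕ) → List (List ℕ)
  go [] cs = cs
  go (e ∷ es) cs = go es (addEdge e cs)

boundaryComponents : ∀ {n} → SignedRotation n → ℕ
boundaryComponents [] = 1
boundaryComponents r@(_ ∷ _) =
  length (components (2 * length r) (boundaryEdges r))

-- spanning ribbon subgraph (V, F): delete occurrences of edges not in F
restrict : ∀ {n} → Subset n → SignedRotation n → SignedRotation n
restrict F r = filterᵇ (λ o → lookup F (proj₂ o)) r

isQuasiTreeᵇ : ∀ {n} → SignedRotation n → Bool
isQuasiTreeᵇ r = boundaryComponents r ≡ᵇ 1

allSubsets : (n : ℕ) → List (Subset n)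
allSubsets zero = [] ∷ []
allSubsets (suc n) = map (true ∷_) (allSubsets n) ++ map (false ∷_) (allSubsets n)

κ : ∀ {n} → SignedRotation n → ℕ
κ {n} r = length (filterᵇ (λ F → isQuasiTreeᵇ (restrict F r)) (allSubsets n))

fib : ℕ → ℕ
fib zero = zero
fib (suc zero) = suc zero
fib (suc (suc k)) = fib (suc k) + fib k

-- The bouquets F_n and F^1_n (edge label i is Fin index i-1).
-- F_n = (1, 2,1, 3,2, ..., n,n-1, n); for n = 0 we put the empty rotation.
middle : (k : ℕ) → SignedRotation (suc k)
middle k = concatMap (λ j → (true , fsuc j) ∷ (true , inject₁ j) ∷ []) (allFin k)

𝔽 : (n : ℕ) → SignedRotation n
𝔽 zero = []
𝔽 (suc k) = (true , fzero) ∷ middle k ++ [ (true , fromℕ k) ]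

-- F^1_n: half-twist on edge 1, i.e. first occurrence of 1 is negative
𝔽¹ : (n : ℕ) → SignedRotation n
𝔽¹ zero = []
𝔽¹ (suc k) = (false , fzero) ∷ middle k ++ [ (true , fromℕ k) ]

{-# OPTIONS --safe #-}
-- Deleting edges of 𝔽¹ₙ leaves maximal runs of consecutive edges whose
-- occurrences do not interlace, so the signed rotation of a spanning subgraph
-- is a concatenation of relabelled copies of 𝔽ₘ, the first one twisted (𝔽¹ₘ)
-- when it contains edge 1, and a concatenation is a quasi-tree iff every
-- piece is.  𝔽¹ₘ is always a quasi-tree and 𝔽ₘ is one iff m is even, by
-- induction on m: replacing the last occurrence of edge m in 𝔽ₘ by a
-- five-letter gadget yields 𝔽ₘ₊₂, and the boundary of the gadget contracts to
-- the two ends of the occurrence it replaces.  Hence κ(𝔽¹ₙ) counts the subsets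
-- of {1, …, n} whose runs avoiding edge 1 all have even length, and these
-- satisfy Fibonacci recurrences.
-- Boundary components are handled through two-colourings of the boundary
-- points that are constant along boundary edges: the boundary is connected iff
-- all of them are constant, and a non-constant one is a cut.
module Submission where

open import Defs
open import Data.Bool using (Bool; true; false; not; _∧_; _∨_; _xor_; if_then_else_; T?)
open import Data.Bool.Properties using (∨-zeroʳ; ∧-identityʳ; T-≡)
open import Data.Nat
open import Data.Nat.Properties
open import Algebra.Properties.CommutativeSemigroup +-commutativeSemigroup using (x∙yz≈y∙xz)
open import Data.Nat.DivMod using (_%_; m<n⇒m%n≡m; n%n≡0)
open import Data.Fin using (Fin; toℕ; fromℕ; inject₁) renaming (zero to fzero; suc to fsuc)
open import Data.Fin.Properties using (toℕ-fromℕ; toℕ-inject₁)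
open import Data.Fin.Subset using (Subset)
open import Data.Vec using ([]; _∷_; lookup)
open import Data.List hiding ([_]; lookup)
import Data.List as List
open import Data.List.Properties
  using (upTo-∷ʳ; map-upTo; ++-identityʳ; ++-assoc; map-++; map-id; length-map; length-++; filter-++;
         concatMap-cong; concatMap-map; map-concatMap; concatMap-++)
open import Data.List.Relation.Binary.Permutation.Propositional using (_↭_; ↭-sym; ↭-trans; ↭-reflexive)
open import Data.List.Relation.Binary.Permutation.Propositional.Properties using (All-resp-↭; shift)
open import Data.List.Relation.Unary.All using (All; []; _∷_)
import Data.List.Relation.Unary.All as All
import Data.List.Relation.Unary.All.Properties as All
open import Data.List.Relation.Unary.Any using (Any; here; there)
open import Data.Product using (_×_; _,_; proj₁; proj₂; Σ; map₁; map₂)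
import Data.Product as Product
open import Data.Sum using (_⊎_; inj₁; inj₂)
import Data.Sum as Sum
open import Data.Empty using (⊥; ⊥-elim)
open import Function using (_∘_; id)
open import Function.Bundles using (Equivalence)
open import Function.Definitions using (Injective)
open import Relation.Binary.PropositionalEquality
open import Relation.Nullary using (yes; no)

-- Connectivity of a graph and the blocks merged by `components`

≡ᵇ-refl : ∀ n → (n ≡ᵇ n) ≡ true
≡ᵇ-refl n = Equivalence.to T-≡ (≡⇒≡ᵇ n n refl)

≢⇒≡ᵇ-false : ∀ m n → m ≢ n → (m ≡ᵇ n) ≡ false
≢⇒≡ᵇ-false m n m≢n with m ≡ᵇ n in eq
... | false = refl
... | true  = ⊥-elim (m≢n (≡ᵇ⇒≡ m n (Equivalence.from T-≡ eq)))

Respects : (ℕ → Bool) → Edge → Set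
Respects P e = P (proj₁ e) ≡ P (proj₂ e)

InRange : ℕ → Edge → Set
InRange N e = proj₁ e < N × proj₂ e < N

Connected : ℕ → List Edge → Set
Connected N es = ∀ P → All (Respects P) es → ∀ v → v < N → P v ≡ P 0

record Cut (N : ℕ) (es : List Edge) : Set where
  constructor cut
  field
    colour    : ℕ → Bool
    respects  : All (Respects colour) es
    point     : ℕ
    point<N   : point < N
    separated : colour point ≢ colour 0

mergeEdges : List Edge → List (List ℕ) → List (List ℕ)
mergeEdges []       cs = cs
mergeEdges (e ∷ es) cs = mergeEdges es (addEdge e cs)

-- The fold inside `components` is local to its where-block; the metavariable
-- `localMerge` is solved by unification against it.
mutual
  private
    localMerge : ℕ → List Edge → List Edge → List (List ℕ) → List (List ℕ)
    localMerge = _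

    localMerge-solution : ∀ N e es → components N (e ∷ es) ≡ components N (e ∷ es)
    localMerge-solution N e es with map List.[_] (upTo N)
    ... | cs with e ∷ es | addEdge e cs
    ... | y | c = refl {x = localMerge N y es c}

components≡mergeEdges : ∀ N es → components N es ≡ mergeEdges es (map List.[_] (upTo N))
components≡mergeEdges N es = go es _
  where
  go : ∀ es′ cs → localMerge N es es′ cs ≡ mergeEdges es′ cs
  go []        cs = refl
  go (e ∷ es′) cs = go es′ (addEdge e cs)

multiplicity : ℕ → List ℕ → ℕ
multiplicity a []       = 0
multiplicity a (x ∷ xs) = if x ≡ᵇ a then suc (multiplicity a xs) else multiplicity a xs

multiplicity-++ : ∀ a xs ys → multiplicity a (xs ++ ys) ≡ multiplicity a xs + multiplicity a ys
multiplicity-++ a []       ys = refl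
multiplicity-++ a (x ∷ xs) ys with x ≡ᵇ a
... | true  = cong suc (multiplicity-++ a xs ys)
... | false = multiplicity-++ a xs ys

memᵇ⇒multiplicity>0 : ∀ {a} xs → memᵇ a xs ≡ true → 0 < multiplicity a xs
memᵇ⇒multiplicity>0 {a} (x ∷ xs) h with x ≡ᵇ a
... | true  = z<s
... | false = memᵇ⇒multiplicity>0 xs h

multiplicity>0⇒memᵇ : ∀ {a} xs → 0 < multiplicity a xs → memᵇ a xs ≡ true
multiplicity>0⇒memᵇ {a} (x ∷ xs) h with x ≡ᵇ a
... | true  = refl
... | false = multiplicity>0⇒memᵇ xs h

¬memᵇ⇒multiplicity≡0 : ∀ {a} xs → memᵇ a xs ≡ false → multiplicity a xs ≡ 0
¬memᵇ⇒multiplicity≡0 []       h = refl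
¬memᵇ⇒multiplicity≡0 {a} (x ∷ xs) h with x ≡ᵇ a
... | false = ¬memᵇ⇒multiplicity≡0 xs h

memᵇ-++⁺ˡ : ∀ {a} xs ys → memᵇ a xs ≡ true → memᵇ a (xs ++ ys) ≡ true
memᵇ-++⁺ˡ {a} (x ∷ xs) ys h with x ≡ᵇ a
... | true  = refl
... | false = memᵇ-++⁺ˡ xs ys h

memᵇ-++⁺ʳ : ∀ {a} xs ys → memᵇ a ys ≡ true → memᵇ a (xs ++ ys) ≡ true
memᵇ-++⁺ʳ     []       ys h = h
memᵇ-++⁺ʳ {a} (x ∷ xs) ys h with x ≡ᵇ a
... | true  = refl
... | false = memᵇ-++⁺ʳ xs ys h

memᵇ-head : ∀ a xs → memᵇ a (a ∷ xs) ≡ true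
memᵇ-head a xs rewrite ≡ᵇ-refl a = refl

multiplicity-map-suc : ∀ a xs → multiplicity (suc a) (map suc xs) ≡ multiplicity a xs
multiplicity-map-suc a []       = refl
multiplicity-map-suc a (x ∷ xs) with x ≡ᵇ a
... | true  = cong suc (multiplicity-map-suc a xs)
... | false = multiplicity-map-suc a xs

multiplicity-zero-map-suc : ∀ xs → multiplicity 0 (map suc xs) ≡ 0
multiplicity-zero-map-suc []       = refl
multiplicity-zero-map-suc (x ∷ xs) = multiplicity-zero-map-suc xs

multiplicity-upTo : ∀ a N → multiplicity a (upTo N) ≡ (if a <ᵇ N then 1 else 0)
multiplicity-upTo a       zero    = refl
multiplicity-upTo zero    (suc N) = cong suc (trans (cong (multiplicity 0) (sym (map-upTo suc N))) (multiplicity-zero-map-suc (upTo N)))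
multiplicity-upTo (suc a) (suc N) = trans (cong (multiplicity (suc a)) (sym (map-upTo suc N)))
                                          (trans (multiplicity-map-suc a (upTo N)) (multiplicity-upTo a N))

multiplicity-upTo-< : ∀ {a N} → a < N → multiplicity a (upTo N) ≡ 1
multiplicity-upTo-< {a} {N} a<N rewrite multiplicity-upTo a N | Equivalence.to T-≡ (<⇒<ᵇ a<N) = refl

multiplicity-upTo-≤1 : ∀ a N → multiplicity a (upTo N) ≤ 1
multiplicity-upTo-≤1 a N rewrite multiplicity-upTo a N with a <ᵇ N
... | true  = ≤-refl
... | false = z≤n

multiplicity-upTo⇒< : ∀ {a N} → 0 < multiplicity a (upTo N) → a < N
multiplicity-upTo⇒< {a} {N} h rewrite multiplicity-upTo a N with a <ᵇ N in eq
... | true = <ᵇ⇒< a N (Equivalence.from T-≡ eq)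

Partition : ℕ → List (List ℕ) → Set
Partition N cs = ∀ v → multiplicity v (concat cs) ≡ multiplicity v (upTo N)

NonEmpty : List ℕ → Set
NonEmpty B = 0 < length B

SameBlock : ℕ → ℕ → List (List ℕ) → Set
SameBlock x y = Any (λ B → memᵇ x B ≡ true × memᵇ y B ≡ true)

Joins : List (List ℕ) → Edge → Set
Joins cs e = SameBlock (proj₁ e) (proj₂ e) cs

touches : ℕ → ℕ → List ℕ → Bool
touches a b B = memᵇ a B ∨ memᵇ b B

multiplicity-filter-split : ∀ v (t : List ℕ → Bool) cs →
  multiplicity v (concat (filterᵇ t cs)) + multiplicity v (concat (filterᵇ (not ∘ t) cs)) ≡ multiplicity v (concat cs)
multiplicity-filter-split v t [] = refl
multiplicity-filter-split v t (B ∷ cs) with t B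
... | true = begin
  μ (B ++ concat (filterᵇ t cs)) + μ (concat (filterᵇ (not ∘ t) cs))
    ≡⟨ cong (_+ μ (concat (filterᵇ (not ∘ t) cs))) (multiplicity-++ v B _) ⟩
  μ B + μ (concat (filterᵇ t cs)) + μ (concat (filterᵇ (not ∘ t) cs))
    ≡⟨ +-assoc (μ B) _ _ ⟩
  μ B + (μ (concat (filterᵇ t cs)) + μ (concat (filterᵇ (not ∘ t) cs)))
    ≡⟨ cong (μ B +_) (multiplicity-filter-split v t cs) ⟩
  μ B + μ (concat cs)
    ≡⟨ multiplicity-++ v B _ ⟨
  μ (B ++ concat cs) ∎
  where
  open ≡-Reasoning
  μ = multiplicity v
... | false = begin
  μ (concat (filterᵇ t cs)) + μ (B ++ concat (filterᵇ (not ∘ t) cs))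
    ≡⟨ cong (μ (concat (filterᵇ t cs)) +_) (multiplicity-++ v B _) ⟩
  μ (concat (filterᵇ t cs)) + (μ B + μ (concat (filterᵇ (not ∘ t) cs)))
    ≡⟨ x∙yz≈y∙xz (μ (concat (filterᵇ t cs))) (μ B) _ ⟩
  μ B + (μ (concat (filterᵇ t cs)) + μ (concat (filterᵇ (not ∘ t) cs)))
    ≡⟨ cong (μ B +_) (multiplicity-filter-split v t cs) ⟩
  μ B + μ (concat cs)
    ≡⟨ multiplicity-++ v B _ ⟨
  μ (B ++ concat cs) ∎
  where
  open ≡-Reasoning
  μ = multiplicity v

multiplicity-addEdge : ∀ v e cs → multiplicity v (concat (addEdge e cs)) ≡ multiplicity v (concat cs)
multiplicity-addEdge v (a , b) cs =
  trans (multiplicity-++ v (concat (filterᵇ (touches a b) cs)) _) (multiplicity-filter-split v (touches a b) cs)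

multiplicity-filter-covering : ∀ v (t : List ℕ → Bool) cs → (∀ B → memᵇ v B ≡ true → t B ≡ true) →
  multiplicity v (concat (filterᵇ t cs)) ≡ multiplicity v (concat cs)
multiplicity-filter-covering v t []       covers = refl
multiplicity-filter-covering v t (B ∷ cs) covers with t B in tB
... | true = trans (multiplicity-++ v B _)
               (trans (cong (multiplicity v B +_) (multiplicity-filter-covering v t cs covers))
                      (sym (multiplicity-++ v B _)))
... | false = trans (multiplicity-filter-covering v t cs covers)
                (sym (trans (multiplicity-++ v B _) (cong (_+ _) (¬memᵇ⇒multiplicity≡0 B v∉B))))
  where
  v∉B : memᵇ v B ≡ false
  v∉B with memᵇ v B in v∈B
  ... | false = refl
  ... | true  with () ← trans (sym (covers B v∈B)) tB

partition-addEdge : ∀ N e cs → Partition N cs → Partition N (addEdge e cs)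
partition-addEdge N e cs part v = trans (multiplicity-addEdge v e cs) (part v)

partition-mergeEdges : ∀ N es cs → Partition N cs → Partition N (mergeEdges es cs)
partition-mergeEdges N []       cs part = part
partition-mergeEdges N (e ∷ es) cs part = partition-mergeEdges N es (addEdge e cs) (partition-addEdge N e cs part)

partition-initial : ∀ N → Partition N (map List.[_] (upTo N))
partition-initial N v = go (upTo N)
  where
  go : ∀ xs → multiplicity v (concat (map List.[_] xs)) ≡ multiplicity v xs
  go []       = refl
  go (x ∷ xs) with x ≡ᵇ v
  ... | true  = cong suc (go xs)
  ... | false = go xs

in-range⇒multiplicity≡1 : ∀ {N v} cs → Partition N cs → v < N → multiplicity v (concat cs) ≡ 1
in-range⇒multiplicity≡1 {v = v} cs part v<N = trans (part v) (multiplicity-upTo-< v<N)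

mergedBlock-multiplicity : ∀ {N a} b cs → Partition N cs → a < N → multiplicity a (concat (filterᵇ (touches a b) cs)) ≡ 1
mergedBlock-multiplicity {a = a} b cs part a<N =
  trans (multiplicity-filter-covering a (touches a b) cs (λ B a∈B → cong (_∨ memᵇ b B) a∈B))
        (in-range⇒multiplicity≡1 cs part a<N)

nonEmpty-addEdge : ∀ {N} e cs → Partition N cs → InRange N e → All NonEmpty cs → All NonEmpty (addEdge e cs)
nonEmpty-addEdge (a , b) cs part (a<N , _) nonEmpty =
  occupied (concat (filterᵇ (touches a b) cs)) (subst (0 <_) (sym (mergedBlock-multiplicity b cs part a<N)) z<s)
  ∷ All.filter⁺ _ nonEmpty
  where
  occupied : ∀ B → 0 < multiplicity a B → NonEmpty B
  occupied (_ ∷ _) _ = z<s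

nonEmpty-mergeEdges : ∀ {N} es cs → Partition N cs → All (InRange N) es → All NonEmpty cs → All NonEmpty (mergeEdges es cs)
nonEmpty-mergeEdges []       cs part []           nonEmpty = nonEmpty
nonEmpty-mergeEdges {N} (e ∷ es) cs part (e<N ∷ es<N) nonEmpty =
  nonEmpty-mergeEdges es (addEdge e cs) (partition-addEdge N e cs part) es<N (nonEmpty-addEdge e cs part e<N nonEmpty)

sameBlock-split : ∀ {x y} (t : List ℕ → Bool) cs → SameBlock x y cs →
  let M = concat (filterᵇ t cs) in
  (memᵇ x M ≡ true × memᵇ y M ≡ true) ⊎ SameBlock x y (filterᵇ (not ∘ t) cs)
sameBlock-split t (B ∷ cs) s with t B | s
... | true  | here (x∈B , y∈B) = inj₁ (memᵇ-++⁺ˡ B _ x∈B , memᵇ-++⁺ˡ B _ y∈B)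
... | true  | there s′ = Sum.map₁ (λ (x∈ , y∈) → memᵇ-++⁺ʳ B _ x∈ , memᵇ-++⁺ʳ B _ y∈) (sameBlock-split t cs s′)
... | false | here p   = inj₂ (here p)
... | false | there s′ = Sum.map₂ there (sameBlock-split t cs s′)

sameBlock-addEdge : ∀ {x y} e cs → SameBlock x y cs → SameBlock x y (addEdge e cs)
sameBlock-addEdge (a , b) cs s = Sum.[ here , there ]′ (sameBlock-split (touches a b) cs s)

sameBlock-mergeEdges : ∀ {x y} es cs → SameBlock x y cs → SameBlock x y (mergeEdges es cs)
sameBlock-mergeEdges []       cs s = s
sameBlock-mergeEdges (e ∷ es) cs s = sameBlock-mergeEdges es (addEdge e cs) (sameBlock-addEdge e cs s)

addEdge-joins : ∀ N e cs → Partition N cs → InRange N e → Joins (addEdge e cs) e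
addEdge-joins N (a , b) cs part (a<N , b<N) = here (inMerged a<N (λ B a∈B → cong (_∨ memᵇ b B) a∈B)
                                                  , inMerged b<N (λ B b∈B → trans (cong (memᵇ a B ∨_) b∈B) (∨-zeroʳ _)))
  where
  inMerged : ∀ {v} → v < N → (∀ B → memᵇ v B ≡ true → touches a b B ≡ true) → memᵇ v (concat (filterᵇ (touches a b) cs)) ≡ true
  inMerged {v} v<N covers = multiplicity>0⇒memᵇ (concat (filterᵇ (touches a b) cs))
    (subst (0 <_) (sym (trans (multiplicity-filter-covering v (touches a b) cs covers) (in-range⇒multiplicity≡1 cs part v<N))) z<s)

mergeEdges-joins : ∀ N es cs → Partition N cs → All (InRange N) es → All (Joins (mergeEdges es cs)) es
mergeEdges-joins N []       cs part []           = []
mergeEdges-joins N (e ∷ es) cs part (e<N ∷ es<N) =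
  sameBlock-mergeEdges es (addEdge e cs) (addEdge-joins N e cs part e<N)
  ∷ mergeEdges-joins N es (addEdge e cs) (partition-addEdge N e cs part) es<N

Monochromatic : (ℕ → Bool) → List ℕ → Set
Monochromatic P B = Σ Bool λ c → All (λ v → P v ≡ c) B

memᵇ⇒colour : ∀ {P : ℕ → Bool} {c a} B → All (λ v → P v ≡ c) B → memᵇ a B ≡ true → P a ≡ c
memᵇ⇒colour {P} {c} {a} (x ∷ B) (Px ∷ PB) a∈ with x ≡ᵇ a in eq
... | true  = subst (λ z → P z ≡ c) (≡ᵇ⇒≡ x a (Equivalence.from T-≡ eq)) Px
... | false = memᵇ⇒colour B PB a∈

mergedBlock-monochromatic : ∀ {P : ℕ → Bool} a b → P a ≡ P b → ∀ cs → All (Monochromatic P) cs →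
  All (λ v → P v ≡ P a) (concat (filterᵇ (touches a b) cs))
mergedBlock-monochromatic a b Pab []       []                = []
mergedBlock-monochromatic {P} a b Pab (B ∷ cs) ((c , PB) ∷ mono) with memᵇ a B in a∈ | memᵇ b B in b∈
... | true  | _     = All.++⁺ (All.map (λ Pv → trans Pv (sym (memᵇ⇒colour B PB a∈))) PB) (mergedBlock-monochromatic a b Pab cs mono)
... | false | true  = All.++⁺ (All.map (λ Pv → trans Pv (sym (trans Pab (memᵇ⇒colour B PB b∈)))) PB) (mergedBlock-monochromatic a b Pab cs mono)
... | false | false = mergedBlock-monochromatic a b Pab cs mono

monochromatic-mergeEdges : ∀ {P} es cs → All (Respects P) es → All (Monochromatic P) cs → All (Monochromatic P) (mergeEdges es cs)
monochromatic-mergeEdges []             cs []           mono = mono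
monochromatic-mergeEdges {P} ((a , b) ∷ es) cs (Pab ∷ Pes) mono =
  monochromatic-mergeEdges es (addEdge (a , b) cs) Pes ((P a , mergedBlock-monochromatic a b Pab cs mono) ∷ All.filter⁺ _ mono)

partition-memᵇ⇒< : ∀ N {v} cs → Partition N cs → memᵇ v (concat cs) ≡ true → v < N
partition-memᵇ⇒< N {v} cs part v∈ = multiplicity-upTo⇒< (subst (0 <_) (part v) (memᵇ⇒multiplicity>0 (concat cs) v∈))

partition-exclusive : ∀ N {v} B cs → Partition N (B ∷ cs) → memᵇ v (concat cs) ≡ true → memᵇ v B ≡ false
partition-exclusive N {v} B cs part v∈cs with memᵇ v B in v∈B
... | false = refl
... | true with ≤-trans (+-mono-≤ (memᵇ⇒multiplicity>0 B v∈B) (memᵇ⇒multiplicity>0 (concat cs) v∈cs)) atMostOnce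
  where
  atMostOnce : multiplicity v B + multiplicity v (concat cs) ≤ 1
  atMostOnce = subst (_≤ 1) (trans (sym (part v)) (multiplicity-++ v B (concat cs))) (multiplicity-upTo-≤1 v N)
...   | s≤s ()

sameBlock⇒memᵇ : ∀ {x y} cs → SameBlock x y cs → memᵇ x (concat cs) ≡ true × memᵇ y (concat cs) ≡ true
sameBlock⇒memᵇ (B ∷ cs) (here (x∈ , y∈)) = memᵇ-++⁺ˡ B _ x∈ , memᵇ-++⁺ˡ B _ y∈
sameBlock⇒memᵇ (B ∷ cs) (there s)        = Product.map (memᵇ-++⁺ʳ B _) (memᵇ-++⁺ʳ B _) (sameBlock⇒memᵇ cs s)

-- If two blocks remained, membership in the first one would be a colouring
-- respecting every edge yet separating the two blocks.
connected⇒single-block : ∀ N es cs → 0 < N → Partition N cs → All NonEmpty cs → All (Joins cs) es → Connected N es → length cs ≡ 1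
connected⇒single-block N es []                      0<N part _ _ _ = ⊥-elim (0≢1+n (trans (part 0) (multiplicity-upTo-< 0<N)))
connected⇒single-block N es (_ ∷ [])                _   _    _ _ _ = refl
connected⇒single-block N es ([] ∷ _ ∷ _)            _   _    (() ∷ _) _ _
connected⇒single-block N es (_ ∷ [] ∷ _)            _   _    (_ ∷ () ∷ _) _ _
connected⇒single-block N es ((w ∷ B) ∷ (w′ ∷ C) ∷ cs) _ part _ joins conn
  with trans (sym w′∉first) (trans (conn inFirst respects w′ w′<N) (trans (sym (conn inFirst respects w w<N)) (memᵇ-head w B)))
  where
  rest = (w′ ∷ C) ∷ cs
  inFirst : ℕ → Bool
  inFirst v = memᵇ v (w ∷ B)
  respects : All (Respects inFirst) es
  respects = All.map respects₁ joins
    where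
    respects₁ : ∀ {e} → Joins ((w ∷ B) ∷ rest) e → Respects inFirst e
    respects₁ (here (x∈ , y∈)) = trans x∈ (sym y∈)
    respects₁ (there s) with sameBlock⇒memᵇ rest s
    ... | x∈ , y∈ = trans (partition-exclusive N (w ∷ B) rest part x∈) (sym (partition-exclusive N (w ∷ B) rest part y∈))
  w′∈rest : memᵇ w′ (concat rest) ≡ true
  w′∈rest = memᵇ-++⁺ˡ (w′ ∷ C) _ (memᵇ-head w′ C)
  w′∉first : inFirst w′ ≡ false
  w′∉first = partition-exclusive N (w ∷ B) rest part w′∈rest
  w<N : w < N
  w<N = partition-memᵇ⇒< N ((w ∷ B) ∷ rest) part (memᵇ-head w (B ++ concat rest))
  w′<N : w′ < N
  w′<N = partition-memᵇ⇒< N ((w ∷ B) ∷ rest) part (memᵇ-++⁺ʳ (w ∷ B) _ w′∈rest)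
... | ()

connected⇒components≡1 : ∀ N es → 0 < N → All (InRange N) es → Connected N es → length (components N es) ≡ 1
connected⇒components≡1 N es 0<N es<N conn = begin
  length (components N es)  ≡⟨ cong length (components≡mergeEdges N es) ⟩
  length (mergeEdges es cs) ≡⟨ connected⇒single-block N es (mergeEdges es cs) 0<N
                                 (partition-mergeEdges N es cs (partition-initial N))
                                 (nonEmpty-mergeEdges es cs (partition-initial N) es<N (singletons (upTo N)))
                                 (mergeEdges-joins N es cs (partition-initial N) es<N) conn ⟩
  1                         ∎
  where
  open ≡-Reasoning
  cs = map List.[_] (upTo N)
  singletons : ∀ xs → All NonEmpty (map List.[_] xs)
  singletons []       = []
  singletons (x ∷ xs) = z<s ∷ singletons xs

cut⇒components≢1 : ∀ N es → Cut N es → length (components N es) ≢ 1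
cut⇒components≢1 N es (cut P respects x x<N separated) one-block =
  onlyBlock (mergeEdges es cs) (trans (cong length (sym (components≡mergeEdges N es))) one-block)
    (partition-mergeEdges N es cs (partition-initial N)) (monochromatic-mergeEdges es cs respects (singletons (upTo N)))
  where
  cs = map List.[_] (upTo N)
  singletons : ∀ xs → All (Monochromatic P) (map List.[_] xs)
  singletons []       = []
  singletons (x ∷ xs) = (P x , refl ∷ []) ∷ singletons xs
  onlyBlock : ∀ cs′ → length cs′ ≡ 1 → Partition N cs′ → All (Monochromatic P) cs′ → ⊥
  onlyBlock (B ∷ []) refl part ((c , PB) ∷ []) = separated (trans (colour-c x<N) (sym (colour-c (≤-trans (s≤s z≤n) x<N))))
    where
    colour-c : ∀ {v} → v < N → P v ≡ c
    colour-c {v} v<N = memᵇ⇒colour B PB (subst (λ B′ → memᵇ v B′ ≡ true) (++-identityʳ B)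
                         (multiplicity>0⇒memᵇ (B ++ []) (subst (0 <_) (sym (in-range⇒multiplicity≡1 (B ∷ []) part v<N)) z<s)))

-- Boundary graphs of words

Occurrence : Set
Occurrence = Bool × ℕ

Word : Set
Word = List Occurrence

label : Occurrence → ℕ
label = proj₂

double : ℕ → ℕ
double zero    = zero
double (suc n) = suc (suc (double n))

left right : ℕ → ℕ
left p  = double p
right p = suc (double p)

ribbonSides : ℕ × Occurrence → ℕ × Occurrence → List Edge
ribbonSides (p , (s , e)) (q , (s′ , e′)) =
  if e ≡ᵇ e′
  then (if not (s xor s′) then (right p , left q) ∷ (right q , left p) ∷ []
                          else (right p , right q) ∷ (left p , left q) ∷ [])
  else []

ribbons : List (ℕ × Occurrence) → List Edge
ribbons []       = []
ribbons (x ∷ xs) = concatMap (ribbonSides x) xs ++ ribbons xs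

positioned : ℕ → Word → List (ℕ × Occurrence)
positioned o []      = []
positioned o (a ∷ w) = (o , a) ∷ positioned (suc o) w

corners : ℕ → ℕ → List Edge
corners o zero          = []
corners o (suc zero)    = []
corners o (suc (suc n)) = (right o , left (suc o)) ∷ corners (suc o) (suc n)

-- The boundary graph of Defs for a word placed at positions o, o+1, …, except
-- for the corner closing the cycle of vertex-boundary arcs.
openBoundary : ℕ → Word → List Edge
openBoundary o w = corners o (length w) ++ ribbons (positioned o w)

closingCorner : ℕ → Edge
closingCorner zero    = (0 , 0)
closingCorner (suc L) = (right L , 0)

boundary : Word → List Edge
boundary w = closingCorner (length w) ∷ openBoundary 0 w

points : Word → ℕ
points w = double (length w)

-- Connectivity is certified without the closing corner, so that certificates
-- of consecutive pieces of a word can be glued along the corner between them.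
QuasiTreeIs : Bool → Word → Set
QuasiTreeIs true  w = Connected (points w) (openBoundary 0 w)
QuasiTreeIs false w = Cut (points w) (boundary w)

double-mono-≤ : ∀ {m n} → m ≤ n → double m ≤ double n
double-mono-≤ z≤n       = z≤n
double-mono-≤ (s≤s m≤n) = s≤s (s≤s (double-mono-≤ m≤n))

left< : ∀ {p B} → p < B → left p < double B
left< {p} p<B = ≤-trans (n≤1+n (right p)) (double-mono-≤ p<B)

right< : ∀ {p B} → p < B → right p < double B
right< = double-mono-≤

corners-inRange : ∀ o n B → o + n ≤ B → All (InRange (double B)) (corners o n)
corners-inRange o zero          B _ = []
corners-inRange o (suc zero)    B _ = []
corners-inRange o (suc (suc n)) B h =
  (right< (≤-trans (n≤1+n (suc o)) o+1<B) , left< o+1<B)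
  ∷ corners-inRange (suc o) (suc n) B (subst (_≤ B) (+-suc o (suc n)) h)
  where
  o+1<B : suc o < B
  o+1<B = subst (_≤ B) (+-comm o 2) (≤-trans (+-monoʳ-≤ o (s≤s (s≤s z≤n))) h)

ribbonSides-inRange : ∀ {B p q} a b → p < B → q < B → All (InRange (double B)) (ribbonSides (p , a) (q , b))
ribbonSides-inRange (s , e) (s′ , e′) p<B q<B with e ≡ᵇ e′
... | false = []
... | true with not (s xor s′)
...   | true  = (right< p<B , left< q<B) ∷ (right< q<B , left< p<B) ∷ []
...   | false = (right< p<B , right< q<B) ∷ (left< p<B , left< q<B) ∷ []

ribbons-inRange : ∀ {B} xs → All (λ x → proj₁ x < B) xs → All (InRange (double B)) (ribbons xs)
ribbons-inRange []             []          = []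
ribbons-inRange ((p , a) ∷ xs) (p<B ∷ xs<B) =
  All.++⁺ (All.concat⁺ (All.map⁺ (All.map (λ {y} y<B → ribbonSides-inRange a (proj₂ y) p<B y<B) xs<B)))
          (ribbons-inRange xs xs<B)

positioned-< : ∀ o w → All (λ x → proj₁ x < o + length w) (positioned o w)
positioned-< o []      = []
positioned-< o (a ∷ w) =
  subst (o <_) (sym (+-suc o (length w))) (s≤s (m≤m+n o (length w)))
  ∷ subst (λ B → All (λ x → proj₁ x < B) (positioned (suc o) w)) (sym (+-suc o (length w))) (positioned-< (suc o) w)

openBoundary-inRange : ∀ w → All (InRange (points w)) (openBoundary 0 w)
openBoundary-inRange w = All.++⁺ (corners-inRange 0 (length w) (length w) ≤-refl)
                                 (ribbons-inRange (positioned 0 w) (positioned-< 0 w))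

toWord : ∀ {n} → SignedRotation n → Word
toWord = map (map₂ toℕ)

double≡2* : ∀ p → double p ≡ 2 * p
double≡2* zero    = refl
double≡2* (suc p) = trans (cong (suc ∘ suc) (double≡2* p)) (sym (*-suc 2 p))

2*+1≡right : ∀ p → 2 * p + 1 ≡ right p
2*+1≡right p = trans (+-comm (2 * p) 1) (cong suc (sym (double≡2* p)))

cornerEdges≡ : ∀ L → cornerEdges (suc L) ≡ corners 0 (suc L) ++ List.[ closingCorner (suc L) ]
cornerEdges≡ L = begin
  map corner (upTo (suc L))                    ≡⟨ cong (map corner) (upTo-∷ʳ L) ⟨
  map corner (upTo L ++ List.[ L ])            ≡⟨ map-++ corner (upTo L) List.[ L ] ⟩
  map corner (upTo L) ++ List.[ corner L ]     ≡⟨ cong₂ (λ cs c → cs ++ List.[ c ]) (inner L id 0 (λ _ → refl) ≤-refl) closing ⟩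
  corners 0 (suc L) ++ List.[ (right L , 0) ]  ∎
  where
  open ≡-Reasoning
  corner : ℕ → Edge
  corner p = (2 * p + 1 , 2 * ((p + 1) % suc L))
  inner : ∀ n (h : ℕ → ℕ) o → (∀ i → h i ≡ o + i) → o + n ≤ L → map corner (applyUpTo h n) ≡ corners o (suc n)
  inner zero    h o h≗ o+n≤L = refl
  inner (suc n) h o h≗ o+n≤L = cong₂ _∷_ first (inner n (h ∘ suc) (suc o) (λ i → trans (h≗ (suc i)) (+-suc o i)) (subst (_≤ L) (+-suc o n) o+n≤L))
    where
    o+1<1+L : o + 1 < suc L
    o+1<1+L = s≤s (≤-trans (+-monoʳ-≤ o (s≤s z≤n)) o+n≤L)
    first : corner (h 0) ≡ (right o , left (suc o))
    first rewrite trans (h≗ 0) (+-identityʳ o) =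
      cong₂ _,_ (2*+1≡right o) (trans (cong (2 *_) (trans (m<n⇒m%n≡m o+1<1+L) (+-comm o 1))) (sym (double≡2* (suc o))))
  closing : corner L ≡ (right L , 0)
  closing = cong₂ _,_ (2*+1≡right L) (cong (2 *_) (trans (cong (_% suc L) (+-comm L 1)) (n%n≡0 (suc L))))

ribbonEdges≡ribbons : ∀ {n} (xs : List (ℕ × (Bool × Fin n))) → ribbonEdges xs ≡ ribbons (map (map₂ (map₂ toℕ)) xs)
ribbonEdges≡ribbons []                   = refl
ribbonEdges≡ribbons ((p , (s , e)) ∷ xs) = cong₂ _++_
  (trans (concatMap-cong (λ (q , (s′ , e′)) → sides≡ q s′ (toℕ e′)) xs)
         (sym (concatMap-map (ribbonSides (p , (s , toℕ e))) (map₂ (map₂ toℕ)) xs)))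
  (ribbonEdges≡ribbons xs)
  where
  sides≡ : ∀ q s′ e′ →
    (if toℕ e ≡ᵇ e′ then (if not (s xor s′) then (2 * p + 1 , 2 * q) ∷ (2 * q + 1 , 2 * p) ∷ []
                                             else (2 * p + 1 , 2 * q + 1) ∷ (2 * p , 2 * q) ∷ [])
                    else [])
    ≡ ribbonSides (p , (s , toℕ e)) (q , (s′ , e′))
  sides≡ q s′ e′ rewrite 2*+1≡right p | 2*+1≡right q | sym (double≡2* p) | sym (double≡2* q) = refl

zip-upTo≡positioned : ∀ {n} (r : SignedRotation n) → map (map₂ (map₂ toℕ)) (zip (upTo (length r)) r) ≡ positioned 0 (toWord r)
zip-upTo≡positioned r = go r id 0 (λ _ → refl)
  where
  go : ∀ {n} (r : SignedRotation n) (h : ℕ → ℕ) o → (∀ i → h i ≡ o + i) →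
       map (map₂ (map₂ toℕ)) (zip (applyUpTo h (length r)) r) ≡ positioned o (toWord r)
  go []      h o h≗ = refl
  go (x ∷ r) h o h≗ = cong₂ _∷_ (cong (_, _) (trans (h≗ 0) (+-identityʳ o)))
                                (go r (h ∘ suc) (suc o) (λ i → trans (h≗ (suc i)) (+-suc o i)))

length-toWord : ∀ {n} (r : SignedRotation n) → length (toWord r) ≡ length r
length-toWord = length-map (map₂ toℕ)

boundaryEdges↭boundary : ∀ {n} x (r : SignedRotation n) → boundaryEdges (x ∷ r) ↭ boundary (toWord (x ∷ r))
boundaryEdges↭boundary x r = ↭-trans (↭-reflexive (begin
  boundaryEdges (x ∷ r)
    ≡⟨ cong₂ _++_ (cornerEdges≡ (length r)) (trans (ribbonEdges≡ribbons (zip (upTo (length (x ∷ r))) (x ∷ r))) (cong ribbons (zip-upTo≡positioned (x ∷ r)))) ⟩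
  (corners 0 (suc (length r)) ++ List.[ closingCorner (suc (length r)) ]) ++ ribbons (positioned 0 w)
    ≡⟨ ++-assoc (corners 0 (suc (length r))) _ _ ⟩
  corners 0 (suc (length r)) ++ closingCorner (suc (length r)) ∷ ribbons (positioned 0 w)
    ≡⟨ cong (λ L → corners 0 (suc L) ++ closingCorner (suc L) ∷ ribbons (positioned 0 w)) (length-toWord r) ⟨
  corners 0 (length w) ++ closingCorner (length w) ∷ ribbons (positioned 0 w) ∎))
  (shift (closingCorner (length w)) (corners 0 (length w)) _)
  where
  open ≡-Reasoning
  w = toWord (x ∷ r)

2*length≡points : ∀ {n} (r : SignedRotation n) → 2 * length r ≡ points (toWord r)
2*length≡points r = trans (sym (double≡2* (length r))) (cong double (sym (length-toWord r)))

boundary-inRange : ∀ a w → All (InRange (points (a ∷ w))) (boundary (a ∷ w))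
boundary-inRange a w = (right< ≤-refl , z<s) ∷ openBoundary-inRange (a ∷ w)

isQuasiTreeᵇ-sound : ∀ b {n} (r : SignedRotation n) → QuasiTreeIs b (toWord r) → isQuasiTreeᵇ r ≡ b
isQuasiTreeᵇ-sound true  []      _ = refl
isQuasiTreeᵇ-sound false []      c = ⊥-elim (n≮0 (Cut.point<N c))
isQuasiTreeᵇ-sound true  (x ∷ r) connected =
  cong (_≡ᵇ 1) (connected⇒components≡1 N es (subst (0 <_) (sym N≡) z<s)
                  (subst (λ M → All (InRange M) es) (sym N≡) (All-resp-↭ (↭-sym perm) (boundary-inRange (map₂ toℕ x) (toWord r))))
                  (λ P Pes → subst (λ M → ∀ v → v < M → P v ≡ P 0) (sym N≡) (connected P (All.tail (All-resp-↭ perm Pes)))))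
  where
  N = 2 * length (x ∷ r)
  es = boundaryEdges (x ∷ r)
  N≡ = 2*length≡points (x ∷ r)
  perm = boundaryEdges↭boundary x r
isQuasiTreeᵇ-sound false (x ∷ r) (cut P respects v v<N separated)
  with length (components (2 * length (x ∷ r)) (boundaryEdges (x ∷ r))) in one
... | zero        = refl
... | suc (suc _) = refl
... | suc zero    = ⊥-elim (cut⇒components≢1 _ _
        (cut P (All-resp-↭ (↭-sym (boundaryEdges↭boundary x r)) respects) v
             (subst (v <_) (sym (2*length≡points (x ∷ r))) v<N) separated) one)

-- Shifting, concatenating and relabelling words

shiftEdge : ℕ → Edge → Edge
shiftEdge d (a , b) = (a + d , b + d)

double-+ : ∀ k p → double (k + p) ≡ double k + double p
double-+ zero    p = refl
double-+ (suc k) p = cong (suc ∘ suc) (double-+ k p)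

left-shift : ∀ k p → left (k + p) ≡ left p + double k
left-shift k p = trans (double-+ k p) (+-comm (double k) (double p))

right-shift : ∀ k p → right (k + p) ≡ right p + double k
right-shift k p = cong suc (left-shift k p)

ribbonSides-shift : ∀ k p a q b →
  ribbonSides (k + p , a) (k + q , b) ≡ map (shiftEdge (double k)) (ribbonSides (p , a) (q , b))
ribbonSides-shift k p (s , e) q (s′ , e′) with e ≡ᵇ e′
... | false = refl
... | true with not (s xor s′)
...   | true  rewrite left-shift k p | left-shift k q = refl
...   | false rewrite left-shift k p | left-shift k q = refl

positioned-shift : ∀ k o w → positioned (k + o) w ≡ map (map₁ (k +_)) (positioned o w)
positioned-shift k o []      = refl
positioned-shift k o (a ∷ w) =
  cong ((k + o , a) ∷_) (trans (cong (λ o′ → positioned o′ w) (sym (+-suc k o))) (positioned-shift k (suc o) w))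

ribbons-map : ∀ (g : ℕ × Occurrence → ℕ × Occurrence) (σ : Edge → Edge) →
  (∀ x y → ribbonSides (g x) (g y) ≡ map σ (ribbonSides x y)) → ∀ xs → ribbons (map g xs) ≡ map σ (ribbons xs)
ribbons-map g σ sides []       = refl
ribbons-map g σ sides (x ∷ xs) = begin
  concatMap (ribbonSides (g x)) (map g xs) ++ ribbons (map g xs)
    ≡⟨ cong₂ _++_ (concatMap-map (ribbonSides (g x)) g xs) (ribbons-map g σ sides xs) ⟩
  concatMap (ribbonSides (g x) ∘ g) xs ++ map σ (ribbons xs)
    ≡⟨ cong (_++ map σ (ribbons xs)) (concatMap-cong (sides x) xs) ⟩
  concatMap (map σ ∘ ribbonSides x) xs ++ map σ (ribbons xs)
    ≡⟨ cong (_++ map σ (ribbons xs)) (map-concatMap σ (ribbonSides x) xs) ⟨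
  map σ (concatMap (ribbonSides x) xs) ++ map σ (ribbons xs)
    ≡⟨ map-++ σ (concatMap (ribbonSides x) xs) _ ⟨
  map σ (concatMap (ribbonSides x) xs ++ ribbons xs) ∎
  where open ≡-Reasoning

corners-shift : ∀ k o n → corners (k + o) n ≡ map (shiftEdge (double k)) (corners o n)
corners-shift k o zero          = refl
corners-shift k o (suc zero)    = refl
corners-shift k o (suc (suc n)) = cong₂ _∷_
  (cong₂ _,_ (right-shift k o) (trans (cong left (sym (+-suc k o))) (left-shift k (suc o))))
  (trans (cong (λ o′ → corners o′ (suc n)) (sym (+-suc k o))) (corners-shift k (suc o) (suc n)))

openBoundary-shift : ∀ k w → openBoundary k w ≡ map (shiftEdge (double k)) (openBoundary 0 w)
openBoundary-shift k w = begin
  corners k (length w) ++ ribbons (positioned k w)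
    ≡⟨ cong (λ k′ → corners k′ (length w) ++ ribbons (positioned k′ w)) (+-identityʳ k) ⟨
  corners (k + 0) (length w) ++ ribbons (positioned (k + 0) w)
    ≡⟨ cong₂ _++_ (corners-shift k 0 (length w)) (trans (cong ribbons (positioned-shift k 0 w))
                                                          (ribbons-map (map₁ (k +_)) σ (λ (p , a) (q , b) → ribbonSides-shift k p a q b) (positioned 0 w))) ⟩
  map σ (corners 0 (length w)) ++ map σ (ribbons (positioned 0 w))
    ≡⟨ map-++ σ (corners 0 (length w)) _ ⟨
  map σ (openBoundary 0 w) ∎
  where
  open ≡-Reasoning
  σ = shiftEdge (double k)

respects-shift⁻ : ∀ {P} k w → All (Respects P) (openBoundary k w) → All (Respects (P ∘ (_+ double k))) (openBoundary 0 w)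
respects-shift⁻ {P} k w h = All.map⁻ (subst (All (Respects P)) (openBoundary-shift k w) h)

respects-shift⁺ : ∀ {P} k w → All (Respects (P ∘ (_+ double k))) (openBoundary 0 w) → All (Respects P) (openBoundary k w)
respects-shift⁺ {P} k w h = subst (All (Respects P)) (sym (openBoundary-shift k w)) (All.map⁺ h)

crossRibbons : List (ℕ × Occurrence) → List (ℕ × Occurrence) → List Edge
crossRibbons xs ys = concatMap (λ x → concatMap (ribbonSides x) ys) xs

module _ {Q : Edge → Set} where

  ribbons-++⁻ : ∀ xs ys → All Q (ribbons (xs ++ ys)) → All Q (ribbons xs) × All Q (ribbons ys) × All Q (crossRibbons xs ys)
  ribbons-++⁻ []       ys h = [] , h , []
  ribbons-++⁻ (x ∷ xs) ys h with All.++⁻ (concatMap (ribbonSides x) (xs ++ ys)) h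
  ... | hx , hxs with All.++⁻ (concatMap (ribbonSides x) xs) (subst (All Q) (concatMap-++ (ribbonSides x) xs ys) hx)
                    | ribbons-++⁻ xs ys hxs
  ...   | hxxs , hxys | hxs′ , hys , hcross = All.++⁺ hxxs hxs′ , hys , All.++⁺ hxys hcross

  ribbons-++⁺ : ∀ xs ys → All Q (ribbons xs) → All Q (ribbons ys) → All Q (crossRibbons xs ys) → All Q (ribbons (xs ++ ys))
  ribbons-++⁺ []       ys _   hys _ = hys
  ribbons-++⁺ (x ∷ xs) ys hxs hys hcross with All.++⁻ (concatMap (ribbonSides x) xs) hxs | All.++⁻ (concatMap (ribbonSides x) ys) hcross
  ... | hxxs , hxs′ | hxys , hcross′ =
    All.++⁺ (subst (All Q) (sym (concatMap-++ (ribbonSides x) xs ys)) (All.++⁺ hxxs hxys)) (ribbons-++⁺ xs ys hxs′ hys hcross′)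

corners-++ : ∀ o m n → corners o (suc m + suc n) ≡ corners o (suc m) ++ (right (o + m) , left (o + suc m)) ∷ corners (o + suc m) (suc n)
corners-++ o zero    n rewrite +-identityʳ o | +-comm o 1 = refl
corners-++ o (suc m) n = cong ((right o , left (suc o)) ∷_) (trans (corners-++ (suc o) m n)
  (cong₂ (λ p q → corners (suc o) (suc m) ++ (right p , left q) ∷ corners q (suc n)) (sym (+-suc o m)) (sym (+-suc o (suc m)))))

positioned-++ : ∀ o u v → positioned o (u ++ v) ≡ positioned o u ++ positioned (o + length u) v
positioned-++ o []      v = cong (λ o′ → positioned o′ v) (sym (+-identityʳ o))
positioned-++ o (a ∷ u) v = cong ((o , a) ∷_) (trans (positioned-++ (suc o) u v)
  (cong (λ o′ → positioned (suc o) u ++ positioned o′ v) (sym (+-suc o (length u)))))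

openBoundary-++ : ∀ a u b v → openBoundary 0 ((a ∷ u) ++ (b ∷ v)) ≡
  (corners 0 (suc (length u)) ++ (right (length u) , left (suc (length u))) ∷ corners (suc (length u)) (suc (length v)))
  ++ ribbons (positioned 0 (a ∷ u) ++ positioned (suc (length u)) (b ∷ v))
openBoundary-++ a u b v = cong₂ _++_ (trans (cong (corners 0) (length-++ (a ∷ u))) (corners-++ 0 (length u) (length v)))
                                     (cong ribbons (positioned-++ 0 (a ∷ u) (b ∷ v)))

module _ {Q : Edge → Set} (a : Occurrence) (u : Word) (b : Occurrence) (v : Word) where

  openBoundary-++⁻ : All Q (openBoundary 0 ((a ∷ u) ++ (b ∷ v))) →
    All Q (openBoundary 0 (a ∷ u)) × Q (right (length u) , left (suc (length u))) × All Q (openBoundary (suc (length u)) (b ∷ v))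
    × All Q (crossRibbons (positioned 0 (a ∷ u)) (positioned (suc (length u)) (b ∷ v)))
  openBoundary-++⁻ h
    with All.++⁻ (corners 0 (suc (length u)) ++ _ ∷ corners (suc (length u)) (suc (length v))) (subst (All Q) (openBoundary-++ a u b v) h)
  ... | hcorners , hribbons with All.++⁻ (corners 0 (suc (length u))) hcorners | ribbons-++⁻ (positioned 0 (a ∷ u)) _ hribbons
  ...   | hcu , (hjunction ∷ hcv) | hru , hrv , hcross = All.++⁺ hcu hru , hjunction , All.++⁺ hcv hrv , hcross

  openBoundary-++⁺ : All Q (openBoundary 0 (a ∷ u)) → Q (right (length u) , left (suc (length u))) → All Q (openBoundary (suc (length u)) (b ∷ v))
    → All Q (crossRibbons (positioned 0 (a ∷ u)) (positioned (suc (length u)) (b ∷ v))) → All Q (openBoundary 0 ((a ∷ u) ++ (b ∷ v)))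
  openBoundary-++⁺ hu hjunction hv hcross with All.++⁻ (corners 0 (suc (length u))) hu | All.++⁻ (corners (suc (length u)) (suc (length v))) hv
  ... | hcu , hru | hcv , hrv = subst (All Q) (sym (openBoundary-++ a u b v))
    (All.++⁺ (All.++⁺ hcu (hjunction ∷ hcv)) (ribbons-++⁺ (positioned 0 (a ∷ u)) _ hru hrv hcross))

ribbonSides-≢ : ∀ p a q b → label a ≢ label b → ribbonSides (p , a) (q , b) ≡ []
ribbonSides-≢ p (s , e) q (s′ , e′) e≢e′ rewrite ≢⇒≡ᵇ-false e e′ e≢e′ = refl

positioned-labels : ∀ {R : ℕ → Set} o w → All (R ∘ label) w → All (R ∘ label ∘ proj₂) (positioned o w)
positioned-labels o []      []       = []
positioned-labels o (a ∷ w) (Ra ∷ Rw) = Ra ∷ positioned-labels (suc o) w Rw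

crossRibbons-separated : ∀ {B} xs ys → All ((_< B) ∘ label ∘ proj₂) xs → All ((B ≤_) ∘ label ∘ proj₂) ys → crossRibbons xs ys ≡ []
crossRibbons-separated []       ys _           _   = refl
crossRibbons-separated {B} (x ∷ xs) ys (x<B ∷ xs<B) B≤ys = cong₂ _++_ (noSides ys B≤ys) (crossRibbons-separated xs ys xs<B B≤ys)
  where
  noSides : ∀ ys → All ((B ≤_) ∘ label ∘ proj₂) ys → concatMap (ribbonSides x) ys ≡ []
  noSides []       []          = refl
  noSides (y ∷ ys) (B≤y ∷ B≤ys) =
    cong₂ _++_ (ribbonSides-≢ (proj₁ x) (proj₂ x) (proj₁ y) (proj₂ y) (λ eq → <⇒≱ x<B (subst (B ≤_) (sym eq) B≤y))) (noSides ys B≤ys)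

glue : ℕ → (ℕ → Bool) → (ℕ → Bool) → ℕ → Bool
glue d A B z = if z <ᵇ d then A z else B (z ∸ d)

glue-< : ∀ d A B {z} → z < d → glue d A B z ≡ A z
glue-< d A B z<d rewrite Equivalence.to T-≡ (<⇒<ᵇ z<d) = refl

glue-+ : ∀ d A B z → glue d A B (z + d) ≡ B z
glue-+ d A B z with z + d <ᵇ d in lt
... | false = cong B (m+n∸n≡m z d)
... | true  = ⊥-elim (m+n≮n z d (<ᵇ⇒< (z + d) d (Equivalence.from T-≡ lt)))

respects-agree : ∀ {P Q : ℕ → Bool} {N} es → All (InRange N) es → (∀ {z} → z < N → P z ≡ Q z) →
  All (Respects Q) es → All (Respects P) es
respects-agree []       []                   P≡Q []        = []
respects-agree (e ∷ es) ((a<N , b<N) ∷ es<N) P≡Q (Qe ∷ Qes) =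
  trans (P≡Q a<N) (trans Qe (sym (P≡Q b<N))) ∷ respects-agree es es<N P≡Q Qes

respects-≗ : ∀ {P Q : ℕ → Bool} es → (∀ z → P z ≡ Q z) → All (Respects Q) es → All (Respects P) es
respects-≗ es P≗Q = All.map (λ {e} Qe → trans (P≗Q (proj₁ e)) (trans Qe (sym (P≗Q (proj₂ e)))))

respects-constant : ∀ {P : ℕ → Bool} {c} es → (∀ z → P z ≡ c) → All (Respects P) es
respects-constant []       P≡c = []
respects-constant (e ∷ es) P≡c = trans (P≡c (proj₁ e)) (sym (P≡c (proj₂ e))) ∷ respects-constant es P≡c

<-or-+ : ∀ d z → z < d ⊎ Σ ℕ (λ y → z ≡ y + d)
<-or-+ d z with z <? d
... | yes z<d = inj₁ z<d
... | no  z≮d = inj₂ (z ∸ d , sym (m∸n+n≡m (≮⇒≥ z≮d)))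

module Concatenation (a : Occurrence) (u : Word) (b : Occurrence) (v : Word) {B : ℕ}
                     (u<B : All ((_< B) ∘ label) (a ∷ u)) (B≤v : All ((B ≤_) ∘ label) (b ∷ v)) where

  private
    U V : Word
    U = a ∷ u
    V = b ∷ v
    d : ℕ
    d = points U

  noCross : ∀ {Q : Edge → Set} → All Q (crossRibbons (positioned 0 U) (positioned (suc (length u)) V))
  noCross {Q} = subst (All Q) (sym (crossRibbons-separated (positioned 0 U) _ (positioned-labels 0 U u<B)
                                                            (positioned-labels (suc (length u)) V B≤v))) []

  points-++ : points (U ++ V) ≡ points V + d
  points-++ = trans (cong double (length-++ U)) (trans (double-+ (length U) (length V)) (+-comm d (points V)))

  closingCorner-++ : closingCorner (length (U ++ V)) ≡ (right (length v) + d , 0)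
  closingCorner-++ = trans (cong (λ L → (right L , 0)) (trans (length-++ u) (+-suc (length u) (length v))))
                           (cong (_, 0) (right-shift (length U) (length v)))

  connected-++ : QuasiTreeIs true U → QuasiTreeIs true V → QuasiTreeIs true (U ++ V)
  connected-++ connU connV P PUV z z<N with openBoundary-++⁻ a u b v PUV
  ... | PU , Pjunction , PV , _ with <-or-+ d z
  ...   | inj₁ z<d        = connU P PU z z<d
  ...   | inj₂ (y , refl) = trans (connV (P ∘ (_+ d)) (respects-shift⁻ (suc (length u)) V PV) y y<)
                                  (trans (sym Pjunction) (connU P PU _ (right< {length u} ≤-refl)))
    where
    y< : y < points V
    y< = +-cancelʳ-< d y (points V) (subst (y + d <_) points-++ z<N)

  cut-++ˡ : QuasiTreeIs false U → QuasiTreeIs false (U ++ V)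
  cut-++ˡ (cut Pu (Pclosing ∷ PU) x x<d separated) =
    cut P (subst (Respects P) (sym closingCorner-++) (trans (glue-+ d Pu K (right (length v))) (sym P0))
           ∷ openBoundary-++⁺ a u b v
               (respects-agree (openBoundary 0 U) (openBoundary-inRange U) (glue-< d Pu K) PU)
               (trans (glue-< d Pu K (right< {length u} ≤-refl)) (trans Pclosing (sym (glue-+ d Pu K 0))))
               (respects-shift⁺ (suc (length u)) V (respects-constant (openBoundary 0 V) (glue-+ d Pu K)))
               noCross)
      x (subst (x <_) (sym points-++) (≤-trans x<d (m≤n+m d (points V))))
      (λ eq → separated (trans (sym (glue-< d Pu K x<d)) (trans eq P0)))
    where
    K : ℕ → Bool
    K _ = Pu 0
    P : ℕ → Bool
    P = glue d Pu K
    P0 : P 0 ≡ Pu 0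
    P0 = glue-< d Pu K z<s

  cut-++ʳ : QuasiTreeIs false V → QuasiTreeIs false (U ++ V)
  cut-++ʳ (cut Pv (Pclosing ∷ PV) x x<N separated) =
    cut P (subst (Respects P) (sym closingCorner-++) (trans (glue-+ d K Pv (right (length v))) (trans Pclosing (sym P0)))
           ∷ openBoundary-++⁺ a u b v
               (respects-agree (openBoundary 0 U) (openBoundary-inRange U) (glue-< d K Pv) (respects-constant {P = K} (openBoundary 0 U) (λ _ → refl)))
               (trans (glue-< d K Pv (right< {length u} ≤-refl)) (sym (glue-+ d K Pv 0)))
               (respects-shift⁺ (suc (length u)) V (respects-≗ (openBoundary 0 V) (glue-+ d K Pv) PV))
               noCross)
      (x + d) (subst (x + d <_) (sym points-++) (+-monoˡ-< d x<N))
      (λ eq → separated (trans (sym (glue-+ d K Pv x)) (trans eq P0)))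
    where
    K : ℕ → Bool
    K _ = Pv 0
    P : ℕ → Bool
    P = glue d K Pv
    P0 : P 0 ≡ Pv 0
    P0 = glue-< d K Pv z<s

quasiTreeIs-++ : ∀ {B} b₁ b₂ u v → All ((_< B) ∘ label) u → All ((B ≤_) ∘ label) v →
  QuasiTreeIs b₁ u → QuasiTreeIs b₂ v → QuasiTreeIs (b₁ ∧ b₂) (u ++ v)
quasiTreeIs-++ true  b₂    []      v       _   _   _  qv = qv
quasiTreeIs-++ false b₂    []      v       _   _   c  _  = ⊥-elim (n≮0 (Cut.point<N c))
quasiTreeIs-++ b₁    true  (a ∷ u) []      _   _   qu _  rewrite ∧-identityʳ b₁ | ++-identityʳ u = qu
quasiTreeIs-++ b₁    false (a ∷ u) []      _   _   _  c  = ⊥-elim (n≮0 (Cut.point<N c))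
quasiTreeIs-++ true  true  (a ∷ u) (b ∷ v) u<B B≤v qu qv = Concatenation.connected-++ a u b v u<B B≤v qu qv
quasiTreeIs-++ true  false (a ∷ u) (b ∷ v) u<B B≤v _  qv = Concatenation.cut-++ʳ a u b v u<B B≤v qv
quasiTreeIs-++ false b₂    (a ∷ u) (b ∷ v) u<B B≤v qu _  = Concatenation.cut-++ˡ a u b v u<B B≤v qu

relabel : (ℕ → ℕ) → Word → Word
relabel f = map (map₂ f)

≡ᵇ-injective : ∀ {f : ℕ → ℕ} → Injective _≡_ _≡_ f → ∀ a b → (f a ≡ᵇ f b) ≡ (a ≡ᵇ b)
≡ᵇ-injective {f} inj a b with a ≟ b
... | yes refl = trans (≡ᵇ-refl (f a)) (sym (≡ᵇ-refl a))
... | no  a≢b  = trans (≢⇒≡ᵇ-false (f a) (f b) (a≢b ∘ inj)) (sym (≢⇒≡ᵇ-false a b a≢b))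

openBoundary-relabel : ∀ {f} → Injective _≡_ _≡_ f → ∀ o w → openBoundary o (relabel f w) ≡ openBoundary o w
openBoundary-relabel {f} inj o w = cong₂ _++_ (cong (corners o) (length-map (map₂ f) w)) (begin
  ribbons (positioned o (relabel f w))          ≡⟨ cong ribbons (positioned-relabel o w) ⟩
  ribbons (map (map₂ (map₂ f)) (positioned o w)) ≡⟨ ribbons-map (map₂ (map₂ f)) id sides (positioned o w) ⟩
  map id (ribbons (positioned o w))             ≡⟨ map-id _ ⟩
  ribbons (positioned o w)                      ∎)
  where
  open ≡-Reasoning
  positioned-relabel : ∀ o w → positioned o (relabel f w) ≡ map (map₂ (map₂ f)) (positioned o w)
  positioned-relabel o []      = refl
  positioned-relabel o (a ∷ w) = cong (_ ∷_) (positioned-relabel (suc o) w)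
  sides : ∀ x y → ribbonSides (map₂ (map₂ f) x) (map₂ (map₂ f) y) ≡ map id (ribbonSides x y)
  sides (p , (s , e)) (q , (s′ , e′)) rewrite ≡ᵇ-injective inj e e′ = sym (map-id _)

quasiTreeIs-relabel : ∀ b {f} → Injective _≡_ _≡_ f → ∀ w → QuasiTreeIs b w → QuasiTreeIs b (relabel f w)
quasiTreeIs-relabel true  {f} inj w = subst₂ Connected (sym samePoints) (sym (openBoundary-relabel inj 0 w))
  where samePoints = cong double (length-map (map₂ f) w)
quasiTreeIs-relabel false {f} inj w = subst₂ Cut (sym samePoints)
  (sym (cong₂ _∷_ (cong closingCorner (length-map (map₂ f) w)) (openBoundary-relabel inj 0 w)))
  where samePoints = cong double (length-map (map₂ f) w)

-- The gadget step 𝔽ₘ ↦ 𝔽ₘ₊₂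

gadget : ℕ → Word
gadget x = (true , suc x) ∷ (true , x) ∷ (true , suc (suc x)) ∷ (true , suc x) ∷ (true , suc (suc x)) ∷ []

-- The open boundary of the gadget has two components: {3, 4, 9}, containing the
-- right end 3 of the occurrence of x, and the rest, containing its left end 2.
inRightComponent : ℕ → Bool
inRightComponent 3 = true
inRightComponent 4 = true
inRightComponent 9 = true
inRightComponent _ = false

gadgetEnd : Bool → ℕ
gadgetEnd false = 2
gadgetEnd true  = 3

gadget-respects⁻ : ∀ P → All (Respects P) (openBoundary 0 (gadget 0)) → ∀ k → k < 10 → P k ≡ P (gadgetEnd (inRightComponent k))
gadget-respects⁻ P (e₁ ∷ e₂ ∷ e₃ ∷ e₄ ∷ e₅ ∷ e₆ ∷ e₇ ∷ e₈ ∷ []) = component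
  where
  P6 = trans (sym e₅) e₁
  P5 = trans e₃ P6
  P8 = trans (sym e₇) P5
  P7 = trans e₄ P8
  component : ∀ k → k < 10 → P k ≡ P (gadgetEnd (inRightComponent k))
  component 0 _ = trans (sym e₆) P7
  component 1 _ = e₁
  component 2 _ = refl
  component 3 _ = refl
  component 4 _ = sym e₂
  component 5 _ = P5
  component 6 _ = P6
  component 7 _ = P7
  component 8 _ = P8
  component 9 _ = trans e₈ (sym e₂)
  component (suc (suc (suc (suc (suc (suc (suc (suc (suc (suc _)))))))))) (s<s (s<s (s<s (s<s (s<s (s<s (s<s (s<s (s<s (s<s ()))))))))))

gadget-respects⁺ : ∀ (Q : Bool → Bool) → All (Respects (Q ∘ inRightComponent)) (openBoundary 0 (gadget 0))
gadget-respects⁺ Q = refl ∷ refl ∷ refl ∷ refl ∷ refl ∷ refl ∷ refl ∷ refl ∷ []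

openBoundary-gadget : ∀ x → openBoundary 0 (gadget x) ≡ openBoundary 0 (gadget 0)
openBoundary-gadget x = openBoundary-relabel (+-cancelʳ-≡ x _ _) 0 (gadget 0)

module GadgetStep (a : Occurrence) (W′ w₁ w₂ : Word) (x : ℕ) (W≡ : a ∷ W′ ≡ w₁ ++ (true , x) ∷ w₂)
                  (w₁<x : All ((_< x) ∘ label) w₁) (w₂<x : All ((_< x) ∘ label) w₂) where

  private
    W : Word
    W = a ∷ W′
    L d p : ℕ
    L = length W
    d = points W
    p = length w₁
    single : Word
    single = (true , x) ∷ []

  p<L : p < L
  p<L = subst (p <_) (sym (trans (cong length W≡) (length-++ w₁)))
                     (subst (p <_) (sym (+-suc p (length w₂))) (s≤s (m≤m+n p (length w₂))))

  length-W++ : ∀ T → length (W ++ T) ≡ length T + L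
  length-W++ T = trans (length-++ W) (+-comm L (length T))

  crossRibbons-occurrence : ∀ T → All ((x ≤_) ∘ label) T →
    crossRibbons (positioned 0 W) (positioned L T) ≡ concatMap (ribbonSides (p , (true , x))) (positioned L T) ++ []
  crossRibbons-occurrence T x≤T = begin
    crossRibbons (positioned 0 W) (positioned L T)
      ≡⟨ cong (λ w → crossRibbons (positioned 0 w) (positioned L T)) W≡ ⟩
    crossRibbons (positioned 0 (w₁ ++ (true , x) ∷ w₂)) (positioned L T)
      ≡⟨ cong (λ xs → crossRibbons xs (positioned L T)) (positioned-++ 0 w₁ ((true , x) ∷ w₂)) ⟩
    crossRibbons (positioned 0 w₁ ++ (p , (true , x)) ∷ positioned (suc p) w₂) (positioned L T)
      ≡⟨ concatMap-++ _ (positioned 0 w₁) _ ⟩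
    crossRibbons (positioned 0 w₁) (positioned L T)
      ++ concatMap (ribbonSides (p , (true , x))) (positioned L T) ++ crossRibbons (positioned (suc p) w₂) (positioned L T)
      ≡⟨ cong₂ (λ l r → l ++ concatMap (ribbonSides (p , (true , x))) (positioned L T) ++ r)
               (crossRibbons-separated _ _ (positioned-labels 0 w₁ w₁<x) (positioned-labels L T x≤T))
               (crossRibbons-separated _ _ (positioned-labels (suc p) w₂ w₂<x) (positioned-labels L T x≤T)) ⟩
    concatMap (ribbonSides (p , (true , x))) (positioned L T) ++ [] ∎
    where open ≡-Reasoning

  crossRibbons-single : crossRibbons (positioned 0 W) (positioned L single) ≡ (right p , left L) ∷ (right L , left p) ∷ []
  crossRibbons-single rewrite crossRibbons-occurrence single (≤-refl ∷ []) | ≡ᵇ-refl x = refl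

  crossRibbons-gadget : crossRibbons (positioned 0 W) (positioned L (gadget x)) ≡ (right p , left (suc L)) ∷ (right (suc L) , left p) ∷ []
  crossRibbons-gadget
    rewrite crossRibbons-occurrence (gadget x) (n≤1+n x ∷ ≤-refl ∷ m≤n+m x 2 ∷ n≤1+n x ∷ m≤n+m x 2 ∷ [])
          | ≡ᵇ-refl x | ≢⇒≡ᵇ-false x (suc x) (<⇒≢ (n<1+n x))
          | ≢⇒≡ᵇ-false x (suc (suc x)) (<⇒≢ (≤-trans (n<1+n x) (n≤1+n (suc x)))) = refl

  gadget-shift⁻ : ∀ {P} → All (Respects P) (openBoundary L (gadget x)) → ∀ k → k < 10 → P (k + d) ≡ P (gadgetEnd (inRightComponent k) + d)
  gadget-shift⁻ {P} PG = gadget-respects⁻ (P ∘ (_+ d)) (subst (All (Respects (P ∘ (_+ d)))) (openBoundary-gadget x) (respects-shift⁻ L (gadget x) PG))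

  gadget-shift⁺ : ∀ {P} (Q : Bool → Bool) → (∀ k → P (k + d) ≡ Q (inRightComponent k)) → All (Respects P) (openBoundary L (gadget x))
  gadget-shift⁺ {P} Q P≗Q = respects-shift⁺ L (gadget x)
    (subst (All (Respects (P ∘ (_+ d)))) (sym (openBoundary-gadget x)) (respects-≗ (openBoundary 0 (gadget 0)) P≗Q (gadget-respects⁺ Q)))

  -- A colouring of the new word induces one of the old word, giving the two
  -- ends of the single occurrence the colours of the two gadget components.
  connected-gadget : QuasiTreeIs true (W ++ single) → QuasiTreeIs true (W ++ gadget x)
  connected-gadget connOld P PNew with openBoundary-++⁻ a W′ (true , suc x) (drop 1 (gadget x)) PNew
  ... | PW , Pjunction , PG , Pcross with subst (All (Respects P)) crossRibbons-gadget Pcross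
  ... | c₁ ∷ c₂ ∷ [] = newConnected
    where
    Q : ℕ → Bool
    Q 0 = P (gadgetEnd false + d)
    Q _ = P (gadgetEnd true + d)
    P′ : ℕ → Bool
    P′ = glue d P Q
    POld : All (Respects P′) (openBoundary 0 (W ++ single))
    POld = openBoundary-++⁺ a W′ (true , x) []
      (respects-agree (openBoundary 0 W) (openBoundary-inRange W) (glue-< d P Q) PW)
      (trans (glue-< d P Q (right< {length W′} ≤-refl)) (trans Pjunction (trans (gadget-shift⁻ PG 0 z<s) (sym (glue-+ d P Q 0)))))
      []
      (subst (All (Respects P′)) (sym crossRibbons-single)
        (trans (glue-< d P Q (right< p<L)) (trans c₁ (sym (glue-+ d P Q 0)))
         ∷ trans (glue-+ d P Q 1) (trans c₂ (sym (glue-< d P Q (left< p<L)))) ∷ []))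
    oldConnected : ∀ v → v < 2 + d → P′ v ≡ P 0
    oldConnected v v<N = trans (connOld P′ POld v (subst (v <_) (cong double (sym (length-W++ single))) v<N)) (glue-< d P Q z<s)
    end : ℕ → ℕ
    end k = if inRightComponent k then 1 else 0
    end<2 : ∀ k → end k < 2
    end<2 k with inRightComponent k
    ... | true  = s<s z<s
    ... | false = z<s
    gadgetEnd≡ : ∀ k → P (gadgetEnd (inRightComponent k) + d) ≡ Q (end k)
    gadgetEnd≡ k with inRightComponent k
    ... | true  = refl
    ... | false = refl
    newConnected : ∀ z → z < points (W ++ gadget x) → P z ≡ P 0
    newConnected z z<N with <-or-+ d z
    ... | inj₁ z<d        = trans (sym (glue-< d P Q z<d)) (oldConnected z (≤-trans z<d (m≤n+m d 2)))
    ... | inj₂ (k , refl) = trans (gadget-shift⁻ PG k k<10)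
                           (trans (gadgetEnd≡ k) (trans (sym (glue-+ d P Q (end k))) (oldConnected (end k + d) (+-monoˡ-< d (end<2 k)))))
      where
      k<10 : k < 10
      k<10 = +-cancelʳ-< d k 10 (subst (k + d <_) (cong double (length-W++ (gadget x))) z<N)

  -- Conversely, a cut of the old word extends to the gadget by colouring each
  -- of its components like the corresponding end of the single occurrence.
  cut-gadget : QuasiTreeIs false (W ++ single) → QuasiTreeIs false (W ++ gadget x)
  cut-gadget (cut P′ (Pclosing ∷ POld) x₀ x₀<N separated) with openBoundary-++⁻ a W′ (true , x) [] POld
  ... | PW , Pjunction , _ , Pcross with subst (All (Respects P′)) crossRibbons-single Pcross
  ... | c₁ ∷ c₂ ∷ [] = cut P PNew y y<N (λ Py≡P0 → separated (trans (sym Py≡P′x₀) (trans Py≡P0 P0)))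
    where
    Q : Bool → Bool
    Q false = P′ (0 + d)
    Q true  = P′ (1 + d)
    R : ℕ → Bool
    R = Q ∘ inRightComponent
    P : ℕ → Bool
    P = glue d P′ R
    P0 : P 0 ≡ P′ 0
    P0 = glue-< d P′ R z<s
    closing≡ : ∀ T → closingCorner (length (W ++ T)) ≡ (right (length T + length W′) , 0)
    closing≡ T = cong (λ n → (right n , 0)) (trans (length-++ W′) (+-comm (length W′) (length T)))
    PNew : All (Respects P) (boundary (W ++ gadget x))
    PNew = subst (Respects P) (sym (closing≡ (gadget x))) (trans (glue-+ d P′ R 9) (trans (subst (Respects P′) (closing≡ single) Pclosing) (sym P0)))
         ∷ openBoundary-++⁺ a W′ (true , suc x) (drop 1 (gadget x))
             (respects-agree (openBoundary 0 W) (openBoundary-inRange W) (glue-< d P′ R) PW)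
             (trans (glue-< d P′ R (right< {length W′} ≤-refl)) (trans Pjunction (sym (glue-+ d P′ R 0))))
             (gadget-shift⁺ Q (glue-+ d P′ R))
             (subst (All (Respects P)) (sym crossRibbons-gadget)
               (trans (glue-< d P′ R (right< p<L)) (trans c₁ (sym (glue-+ d P′ R 2)))
                ∷ trans (glue-+ d P′ R 3) (trans c₂ (sym (glue-< d P′ R (left< p<L)))) ∷ []))
    y<N′ : ∀ k → k < 10 → k + d < points (W ++ gadget x)
    y<N′ k k<10 = subst (k + d <_) (cong double (sym (length-W++ (gadget x)))) (+-monoˡ-< d k<10)
    witness : Σ ℕ λ y → y < points (W ++ gadget x) × P y ≡ P′ x₀
    witness with <-or-+ d x₀
    ... | inj₁ x₀<d = x₀ , ≤-trans x₀<d (≤-trans (m≤n+m d 10) (≤-reflexive (cong double (sym (length-W++ (gadget x)))))) , glue-< d P′ R x₀<d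
    ... | inj₂ (0 , refl) = 2 + d , y<N′ 2 (s≤s (s≤s (s≤s z≤n))) , glue-+ d P′ R 2
    ... | inj₂ (1 , refl) = 3 + d , y<N′ 3 (s≤s (s≤s (s≤s (s≤s z≤n)))) , glue-+ d P′ R 3
    ... | inj₂ (suc (suc k) , refl) = ⊥-elim (<⇒≱ x₀<N (subst (_≤ suc (suc k) + d) (cong double (sym (length-W++ single))) (+-monoˡ-≤ d (s≤s (s≤s z≤n)))))
    y = proj₁ witness
    y<N = proj₁ (proj₂ witness)
    Py≡P′x₀ = proj₂ (proj₂ witness)

quasiTreeIs-gadget : ∀ b a W′ w₁ w₂ x → a ∷ W′ ≡ w₁ ++ (true , x) ∷ w₂ → All ((_< x) ∘ label) w₁ → All ((_< x) ∘ label) w₂ →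
  QuasiTreeIs b ((a ∷ W′) ++ List.[ (true , x) ]) → QuasiTreeIs b ((a ∷ W′) ++ gadget x)
quasiTreeIs-gadget true  = GadgetStep.connected-gadget
quasiTreeIs-gadget false = GadgetStep.cut-gadget

-- Chains: the bouquets 𝔽ₘ and 𝔽¹ₘ

chainTail : ℕ → ℕ → Word
chainTail s zero    = (true , s) ∷ []
chainTail s (suc k) = (true , suc s) ∷ (true , s) ∷ chainTail (suc s) k

-- chain true s m and chain false s m are the words of 𝔽 m and 𝔽¹ m with the
-- edges labelled s, s + 1, …, s + m - 1.
chain : Bool → ℕ → ℕ → Word
chain t s zero    = []
chain t s (suc k) = (t , s) ∷ chainTail s k

chainPairs : ℕ → ℕ → Word
chainPairs s zero    = []
chainPairs s (suc j) = chainPairs s j ++ (true , suc (s + j)) ∷ (true , s + j) ∷ []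

chainPairs-++ : ∀ s j n → chainPairs s j ++ chainTail (s + j) n ≡ chainTail s (j + n)
chainPairs-++ s zero    n = cong (λ s′ → chainTail s′ n) (+-identityʳ s)
chainPairs-++ s (suc j) n = begin
  (chainPairs s j ++ (true , suc (s + j)) ∷ (true , s + j) ∷ []) ++ chainTail (s + suc j) n
    ≡⟨ ++-assoc (chainPairs s j) _ _ ⟩
  chainPairs s j ++ (true , suc (s + j)) ∷ (true , s + j) ∷ chainTail (s + suc j) n
    ≡⟨ cong (λ s′ → chainPairs s j ++ (true , suc (s + j)) ∷ (true , s + j) ∷ chainTail s′ n) (+-suc s j) ⟩
  chainPairs s j ++ chainTail (s + j) (suc n)
    ≡⟨ chainPairs-++ s j (suc n) ⟩
  chainTail s (j + suc n)
    ≡⟨ cong (chainTail s) (+-suc j n) ⟩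
  chainTail s (suc j + n) ∎
  where open ≡-Reasoning

chain-snoc : ∀ t s j → chain t s (suc j) ≡ ((t , s) ∷ chainPairs s j) ++ List.[ (true , s + j) ]
chain-snoc t s j = cong ((t , s) ∷_) (sym (trans (chainPairs-++ s j 0) (cong (chainTail s) (+-identityʳ j))))

chain-gadget : ∀ t j → chain t 0 (3 + j) ≡ ((t , 0) ∷ chainPairs 0 j) ++ gadget j
chain-gadget t j = trans (chain-snoc t 0 (2 + j))
  (cong ((t , 0) ∷_) (trans (++-assoc (chainPairs 0 (suc j)) _ _) (++-assoc (chainPairs 0 j) _ _)))

chainPairs-labels : ∀ s j → All (λ o → s ≤ label o × label o ≤ s + j) (chainPairs s j)
chainPairs-labels s zero    = []
chainPairs-labels s (suc j) = All.++⁺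
  (All.map (λ (s≤ , ≤s+j) → s≤ , ≤-trans ≤s+j (+-monoʳ-≤ s (n≤1+n j))) (chainPairs-labels s j))
  ((≤-trans (m≤m+n s j) (n≤1+n (s + j)) , ≤-reflexive (sym (+-suc s j))) ∷ (m≤m+n s j , +-monoʳ-≤ s (n≤1+n j)) ∷ [])

chain-suc : ∀ t s m → relabel suc (chain t s m) ≡ chain t (suc s) m
chain-suc t s zero    = refl
chain-suc t s (suc k) = cong ((t , suc s) ∷_) (chainTail-suc s k)
  where
  chainTail-suc : ∀ s k → relabel suc (chainTail s k) ≡ chainTail (suc s) k
  chainTail-suc s zero    = refl
  chainTail-suc s (suc k) = cong (λ w → (true , suc (suc s)) ∷ (true , suc s) ∷ w) (chainTail-suc (suc s) k)

isEven : ℕ → Bool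
isEven zero          = true
isEven (suc zero)    = false
isEven (suc (suc n)) = isEven n

chainQT : Bool → ℕ → Bool
chainQT true  m = isEven m
chainQT false m = true

𝔽₁-cut : QuasiTreeIs false (chain true 0 1)
𝔽₁-cut = cut P (refl ∷ refl ∷ refl ∷ refl ∷ []) 1 (s≤s (s≤s z≤n)) (λ ())
  where
  P : ℕ → Bool
  P 1 = true
  P 2 = true
  P _ = false

𝔽₂-connected : QuasiTreeIs true (chain true 0 2)
𝔽₂-connected P (e₁ ∷ e₂ ∷ e₃ ∷ e₄ ∷ e₅ ∷ e₆ ∷ e₇ ∷ []) = component
  where
  P6 = trans (sym e₃) e₅
  P3 = trans e₆ P6
  P4 = trans (sym e₂) P3
  P1 = trans e₄ P4
  P2 = trans (sym e₁) P1
  component : ∀ v → v < 8 → P v ≡ P 0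
  component 0 _ = refl
  component 1 _ = P1
  component 2 _ = P2
  component 3 _ = P3
  component 4 _ = P4
  component 5 _ = e₅
  component 6 _ = P6
  component 7 _ = trans e₇ P2
  component (suc (suc (suc (suc (suc (suc (suc (suc _)))))))) (s≤s (s≤s (s≤s (s≤s (s≤s (s≤s (s≤s (s≤s ()))))))))

𝔽¹₁-connected : QuasiTreeIs true (chain false 0 1)
𝔽¹₁-connected P (e₁ ∷ e₂ ∷ e₃ ∷ []) = component
  where
  P2 = sym e₃
  P1 = trans e₁ P2
  component : ∀ v → v < 4 → P v ≡ P 0
  component 0 _ = refl
  component 1 _ = P1
  component 2 _ = P2
  component 3 _ = trans (sym e₂) P1
  component (suc (suc (suc (suc _)))) (s≤s (s≤s (s≤s (s≤s ()))))

𝔽¹₂-connected : QuasiTreeIs true (chain false 0 2)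
𝔽¹₂-connected P (e₁ ∷ e₂ ∷ e₃ ∷ e₄ ∷ e₅ ∷ e₆ ∷ e₇ ∷ []) = component
  where
  P4 = sym e₅
  P3 = trans e₂ P4
  P6 = trans (sym e₆) P3
  P5 = trans e₃ P6
  P1 = trans e₄ P5
  P2 = trans (sym e₁) P1
  component : ∀ v → v < 8 → P v ≡ P 0
  component 0 _ = refl
  component 1 _ = P1
  component 2 _ = P2
  component 3 _ = P3
  component 4 _ = P4
  component 5 _ = P5
  component 6 _ = P6
  component 7 _ = trans e₇ P2
  component (suc (suc (suc (suc (suc (suc (suc (suc _)))))))) (s≤s (s≤s (s≤s (s≤s (s≤s (s≤s (s≤s (s≤s ()))))))))

𝔽¹₃-connected : QuasiTreeIs true (chain false 0 3)
𝔽¹₃-connected P (e₁ ∷ e₂ ∷ e₃ ∷ e₄ ∷ e₅ ∷ e₆ ∷ e₇ ∷ e₈ ∷ e₉ ∷ e₁₀ ∷ e₁₁ ∷ []) = component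
  where
  P4  = sym e₇
  P3  = trans e₂ P4
  P8  = trans (sym e₈) P3
  P7  = trans e₄ P8
  P10 = trans (sym e₁₀) P7
  P9  = trans e₅ P10
  P2  = trans (sym e₉) P9
  P1  = trans e₁ P2
  P5  = trans (sym e₆) P1
  P6  = trans (sym e₃) P5
  component : ∀ v → v < 12 → P v ≡ P 0
  component 0  _ = refl
  component 1  _ = P1
  component 2  _ = P2
  component 3  _ = P3
  component 4  _ = P4
  component 5  _ = P5
  component 6  _ = P6
  component 7  _ = P7
  component 8  _ = P8
  component 9  _ = P9
  component 10 _ = P10
  component 11 _ = trans e₁₁ P6
  component (suc (suc (suc (suc (suc (suc (suc (suc (suc (suc (suc (suc _)))))))))))) (s≤s (s≤s (s≤s (s≤s (s≤s (s≤s (s≤s (s≤s (s≤s (s≤s (s≤s (s≤s ()))))))))))))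

𝔽₁-step : ∀ b → QuasiTreeIs b (chain true 0 1) → QuasiTreeIs b (chain true 0 3)
𝔽₁-step b q = subst (QuasiTreeIs b) (sym (chain-gadget true 0))
  (quasiTreeIs-gadget b (true , 0) [] [] [] 0 refl [] [] (subst (QuasiTreeIs b) (chain-snoc true 0 0) q))

chain-step : ∀ b t i → QuasiTreeIs b (chain t 0 (2 + i)) → QuasiTreeIs b (chain t 0 (4 + i))
chain-step b t i q = subst (QuasiTreeIs b) (sym (chain-gadget t (suc i)))
  (quasiTreeIs-gadget b (t , 0) (chainPairs 0 (suc i)) ((t , 0) ∷ chainPairs 0 i) ((true , i) ∷ []) (suc i) refl
    (z<s ∷ All.map (λ (_ , ≤i) → s≤s ≤i) (chainPairs-labels 0 i)) (≤-refl ∷ [])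
    (subst (QuasiTreeIs b) (chain-snoc t 0 (suc i)) q))

empty-connected : QuasiTreeIs true []
empty-connected P _ v ()

chain-quasiTree : ∀ t s m → QuasiTreeIs (chainQT t m) (chain t s m)
chain-quasiTree t (suc s) m = subst (QuasiTreeIs (chainQT t m)) (chain-suc t s m)
  (quasiTreeIs-relabel (chainQT t m) suc-injective (chain t s m) (chain-quasiTree t s m))
chain-quasiTree true  zero 0 = empty-connected
chain-quasiTree true  zero 1 = 𝔽₁-cut
chain-quasiTree true  zero 2 = 𝔽₂-connected
chain-quasiTree true  zero 3 = 𝔽₁-step false 𝔽₁-cut
chain-quasiTree true  zero (suc (suc (suc (suc i)))) = chain-step (isEven i) true i (chain-quasiTree true zero (suc (suc i)))
chain-quasiTree false zero 0 = empty-connected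
chain-quasiTree false zero 1 = 𝔽¹₁-connected
chain-quasiTree false zero 2 = 𝔽¹₂-connected
chain-quasiTree false zero 3 = 𝔽¹₃-connected
chain-quasiTree false zero (suc (suc (suc (suc i)))) = chain-step true false i (chain-quasiTree false zero (suc (suc i)))

-- Spanning subgraphs of chains

chainTail-labels : ∀ s k → All (λ o → s ≤ label o × label o ≤ s + k) (chainTail s k)
chainTail-labels s zero    = (≤-refl , m≤m+n s 0) ∷ []
chainTail-labels s (suc k) =
  (n≤1+n s , subst (suc s ≤_) (sym (+-suc s k)) (s≤s (m≤m+n s k)))
  ∷ (≤-refl , m≤m+n s (suc k))
  ∷ All.map (λ (1+s≤ , ≤1+s+k) → ≤-trans (n≤1+n s) 1+s≤ , ≤-trans ≤1+s+k (≤-reflexive (sym (+-suc s k)))) (chainTail-labels (suc s) k)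

chain-labels : ∀ t s k → All (λ o → label o < suc (s + k)) (chain t s (suc k))
chain-labels t s k = s≤s (m≤m+n s k) ∷ All.map (λ (_ , ≤s+k) → s≤s ≤s+k) (chainTail-labels s k)

chain-labels-≥ : ∀ t s n → All ((s ≤_) ∘ label) (chain t s n)
chain-labels-≥ t s zero    = []
chain-labels-≥ t s (suc k) = ≤-refl ∷ All.map proj₁ (chainTail-labels s k)

keep : (ℕ → Bool) → Word → Word
keep g []      = []
keep g (o ∷ w) = if g (label o) then o ∷ keep g w else keep g w

keep-All : ∀ {R : Occurrence → Set} g w → All R w → All R (keep g w)
keep-All g []      []       = []
keep-All g (o ∷ w) (Ro ∷ Rw) with g (label o)
... | true  = Ro ∷ keep-All g w Rw
... | false = keep-All g w Rw

keep-chainTail-dropped : ∀ g s k → g s ≡ false → keep g (chainTail s k) ≡ keep g (chain true (suc s) k)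
keep-chainTail-dropped g s zero    dropped rewrite dropped = refl
keep-chainTail-dropped g s (suc k) dropped rewrite dropped = refl

-- restrictedQT t g s n decides whether keep g (chain t s n) is a quasi-tree;
-- runQT t m g s n does the same when the m edges before label s are kept.
mutual
  restrictedQT : Bool → (ℕ → Bool) → ℕ → ℕ → Bool
  restrictedQT t g s zero    = true
  restrictedQT t g s (suc n) = if g s then runQT t 1 g (suc s) n else restrictedQT true g (suc s) n

  runQT : Bool → ℕ → (ℕ → Bool) → ℕ → ℕ → Bool
  runQT t m g s zero    = chainQT t m
  runQT t m g s (suc n) = if g s then runQT t (suc m) g (suc s) n else chainQT t m ∧ restrictedQT true g (suc s) n

mutual
  quasiTreeIs-keep-chain : ∀ t g s n → QuasiTreeIs (restrictedQT t g s n) (keep g (chain t s n))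
  quasiTreeIs-keep-chain t g s zero    = empty-connected
  quasiTreeIs-keep-chain t g s (suc k) with g s in kept
  ... | true  = subst (λ s′ → QuasiTreeIs (runQT t 1 g (suc s′) k) ((t , s) ∷ keep g (chainTail s′ k))) (+-identityʳ s)
                  (quasiTreeIs-keep-run t g s 0 k (trans (cong g (+-identityʳ s)) kept))
  ... | false = subst (QuasiTreeIs (restrictedQT true g (suc s) k)) (sym (keep-chainTail-dropped g s k kept))
                  (quasiTreeIs-keep-chain true g (suc s) k)

  quasiTreeIs-keep-run : ∀ t g s j n → g (s + j) ≡ true →
    QuasiTreeIs (runQT t (suc j) g (suc (s + j)) n) (((t , s) ∷ chainPairs s j) ++ keep g (chainTail (s + j) n))
  quasiTreeIs-keep-run t g s j zero    kept rewrite kept = subst (QuasiTreeIs (chainQT t (suc j))) (chain-snoc t s j) (chain-quasiTree t s (suc j))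
  quasiTreeIs-keep-run t g s j (suc n) kept with g (suc (s + j)) in kept′
  ... | true rewrite kept =
    subst (λ s′ → QuasiTreeIs (runQT t (suc (suc j)) g (suc s′) n) (run ++ (true , suc (s + j)) ∷ (true , s + j) ∷ keep g (chainTail s′ n)))
          (+-suc s j)
          (subst (QuasiTreeIs (runQT t (suc (suc j)) g (suc (s + suc j)) n)) (cong ((t , s) ∷_) (++-assoc (chainPairs s j) _ _))
                 (quasiTreeIs-keep-run t g s (suc j) n (trans (cong g (+-suc s j)) kept′)))
    where
    run = (t , s) ∷ chainPairs s j
  ... | false rewrite kept =
    subst (QuasiTreeIs (chainQT t (suc j) ∧ restrictedQT true g (suc (suc (s + j))) n)) splitRun
      (quasiTreeIs-++ (chainQT t (suc j)) (restrictedQT true g (suc (suc (s + j))) n) (chain t s (suc j)) _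
        (chain-labels t s j) (keep-All g _ (All.map (≤-trans (n≤1+n _)) (chain-labels-≥ true (suc (suc (s + j))) n)))
        (chain-quasiTree t s (suc j)) (quasiTreeIs-keep-chain true g (suc (suc (s + j))) n))
    where
    run = (t , s) ∷ chainPairs s j
    splitRun : chain t s (suc j) ++ keep g (chain true (suc (suc (s + j))) n) ≡ run ++ (true , s + j) ∷ keep g (chainTail (suc (s + j)) n)
    splitRun = begin
      chain t s (suc j) ++ keep g (chain true (suc (suc (s + j))) n)
        ≡⟨ cong (_++ keep g (chain true (suc (suc (s + j))) n)) (chain-snoc t s j) ⟩
      (run ++ List.[ (true , s + j) ]) ++ keep g (chain true (suc (suc (s + j))) n)
        ≡⟨ ++-assoc run _ _ ⟩
      run ++ (true , s + j) ∷ keep g (chain true (suc (suc (s + j))) n)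
        ≡⟨ cong (λ w → run ++ (true , s + j) ∷ w) (keep-chainTail-dropped g (suc (s + j)) n kept′) ⟨
      run ++ (true , s + j) ∷ keep g (chainTail (suc (s + j)) n) ∎
      where open ≡-Reasoning

toWord-𝔽¹ : ∀ n → toWord (𝔽¹ n) ≡ chain false 0 n
toWord-𝔽¹ zero    = refl
toWord-𝔽¹ (suc k) = cong ((false , 0) ∷_) (begin
  toWord (middle k ++ List.[ (true , fromℕ k) ])     ≡⟨ map-++ (map₂ toℕ) (middle k) _ ⟩
  toWord (middle k) ++ List.[ (true , toℕ (fromℕ k)) ] ≡⟨ cong (λ l → toWord (middle k) ++ List.[ (true , l) ]) (toℕ-fromℕ k) ⟩
  toWord (middle k) ++ List.[ (true , k) ]           ≡⟨ pairs k id 0 (λ _ → refl) ⟩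
  chainTail 0 k                                      ∎)
  where
  open ≡-Reasoning
  pairs : ∀ {K} k (h : Fin k → Fin K) s → (∀ i → toℕ (h i) ≡ s + toℕ i) →
    toWord (concatMap (λ j → (true , fsuc j) ∷ (true , inject₁ j) ∷ []) (tabulate h)) ++ List.[ (true , s + k) ] ≡ chainTail s k
  pairs zero    h s h≗ = cong (λ l → List.[ (true , l) ]) (+-identityʳ s)
  pairs (suc k) h s h≗ = trans
    (cong₂ (λ l l′ → (true , suc l) ∷ (true , l′) ∷ rest ++ List.[ (true , s + suc k) ]) h0≡s (trans (toℕ-inject₁ (h fzero)) h0≡s))
    (cong (λ w → (true , suc s) ∷ (true , s) ∷ w)
          (trans (cong (λ l → rest ++ List.[ (true , l) ]) (+-suc s k)) (pairs k (h ∘ fsuc) (suc s) (λ i → trans (h≗ (fsuc i)) (+-suc s (toℕ i))))))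
    where
    h0≡s : toℕ (h fzero) ≡ s
    h0≡s = trans (h≗ fzero) (+-identityʳ s)
    rest : Word
    rest = toWord (concatMap (λ j → (true , fsuc j) ∷ (true , inject₁ j) ∷ []) (tabulate (h ∘ fsuc)))

inSubset : ∀ {n} → Subset n → ℕ → Bool
inSubset []      _       = false
inSubset (b ∷ F) zero    = b
inSubset (b ∷ F) (suc i) = inSubset F i

lookup≡inSubset : ∀ {n} (F : Subset n) e → lookup F e ≡ inSubset F (toℕ e)
lookup≡inSubset (b ∷ F) fzero    = refl
lookup≡inSubset (b ∷ F) (fsuc e) = lookup≡inSubset F e

toWord-restrict : ∀ {n} (F : Subset n) r → toWord (restrict F r) ≡ keep (inSubset F) (toWord r)
toWord-restrict F []            = refl
toWord-restrict F ((s , e) ∷ r) rewrite sym (lookup≡inSubset F e) with lookup F e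
... | true  = cong ((s , toℕ e) ∷_) (toWord-restrict F r)
... | false = toWord-restrict F r

isQuasiTreeᵇ-𝔽¹ : ∀ n (F : Subset n) → isQuasiTreeᵇ (restrict F (𝔽¹ n)) ≡ restrictedQT false (inSubset F) 0 n
isQuasiTreeᵇ-𝔽¹ n F = isQuasiTreeᵇ-sound _ (restrict F (𝔽¹ n))
  (subst (QuasiTreeIs _) (sym (trans (toWord-restrict F (𝔽¹ n)) (cong (keep (inSubset F)) (toWord-𝔽¹ n))))
         (quasiTreeIs-keep-chain false (inSubset F) 0 n))

-- Counting

count : ∀ {n} → (Subset n → Bool) → ℕ
count {n} p = length (filterᵇ p (allSubsets n))

module _ {A : Set} where

  length-filterᵇ-++ : ∀ (p : A → Bool) xs ys → length (filterᵇ p (xs ++ ys)) ≡ length (filterᵇ p xs) + length (filterᵇ p ys)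
  length-filterᵇ-++ p xs ys = trans (cong length (filter-++ (T? ∘ p) xs ys)) (length-++ (filterᵇ p xs))

  length-filterᵇ-map : ∀ {B : Set} (p : B → Bool) (f : A → B) xs → length (filterᵇ p (map f xs)) ≡ length (filterᵇ (p ∘ f) xs)
  length-filterᵇ-map p f []       = refl
  length-filterᵇ-map p f (x ∷ xs) with p (f x)
  ... | true  = cong suc (length-filterᵇ-map p f xs)
  ... | false = length-filterᵇ-map p f xs

  length-filterᵇ-cong : ∀ {p q : A → Bool} → (∀ x → p x ≡ q x) → ∀ xs → length (filterᵇ p xs) ≡ length (filterᵇ q xs)
  length-filterᵇ-cong p≗q []       = refl
  length-filterᵇ-cong {q = q} p≗q (x ∷ xs) rewrite p≗q x with q x
  ... | true  = cong suc (length-filterᵇ-cong p≗q xs)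
  ... | false = length-filterᵇ-cong p≗q xs

  length-filterᵇ-false : ∀ xs → length (filterᵇ (λ (_ : A) → false) xs) ≡ 0
  length-filterᵇ-false []       = refl
  length-filterᵇ-false (x ∷ xs) = length-filterᵇ-false xs

count-cons : ∀ {n} (p : Subset (suc n) → Bool) {q r : Subset n → Bool} →
  (∀ F → p (true ∷ F) ≡ q F) → (∀ F → p (false ∷ F) ≡ r F) → count p ≡ count q + count r
count-cons {n} p {q} {r} p≗q p≗r = begin
  length (filterᵇ p (map (true ∷_) (allSubsets n) ++ map (false ∷_) (allSubsets n)))
    ≡⟨ length-filterᵇ-++ p (map (true ∷_) (allSubsets n)) _ ⟩
  length (filterᵇ p (map (true ∷_) (allSubsets n))) + length (filterᵇ p (map (false ∷_) (allSubsets n)))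
    ≡⟨ cong₂ _+_ (trans (length-filterᵇ-map p (true ∷_) (allSubsets n)) (length-filterᵇ-cong p≗q (allSubsets n)))
                 (trans (length-filterᵇ-map p (false ∷_) (allSubsets n)) (length-filterᵇ-cong p≗r (allSubsets n))) ⟩
  count q + count r ∎
  where open ≡-Reasoning

mutual
  restrictedQT-suc : ∀ t g s n → restrictedQT t g (suc s) n ≡ restrictedQT t (g ∘ suc) s n
  restrictedQT-suc t g s zero    = refl
  restrictedQT-suc t g s (suc n) = cong₂ (if g (suc s) then_else_) (runQT-suc t 1 g (suc s) n) (restrictedQT-suc true g (suc s) n)

  runQT-suc : ∀ t m g s n → runQT t m g (suc s) n ≡ runQT t m (g ∘ suc) s n
  runQT-suc t m g s zero    = refl
  runQT-suc t m g s (suc n) =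
    cong₂ (if g (suc s) then_else_) (runQT-suc t (suc m) g (suc s) n) (cong (chainQT t m ∧_) (restrictedQT-suc true g (suc s) n))

subsetQT : Bool → ∀ {n} → Subset n → Bool
subsetQT t {n} F = restrictedQT t (inSubset F) 0 n

subsetRunQT : Bool → ℕ → ∀ {n} → Subset n → Bool
subsetRunQT t m {n} F = runQT t m (inSubset F) 0 n

subsetQT-∷ : ∀ t {n} b (F : Subset n) → subsetQT t (b ∷ F) ≡ (if b then subsetRunQT t 1 F else subsetQT true F)
subsetQT-∷ t {n} b F = cong₂ (if b then_else_) (runQT-suc t 1 (inSubset (b ∷ F)) 0 n) (restrictedQT-suc true (inSubset (b ∷ F)) 0 n)

subsetRunQT-∷ : ∀ t m {n} b (F : Subset n) → subsetRunQT t m (b ∷ F) ≡ (if b then subsetRunQT t (suc m) F else chainQT t m ∧ subsetQT true F)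
subsetRunQT-∷ t m {n} b F = cong₂ (if b then_else_) (runQT-suc t (suc m) (inSubset (b ∷ F)) 0 n)
                                                     (cong (chainQT t m ∧_) (restrictedQT-suc true (inSubset (b ∷ F)) 0 n))

isEven-suc : ∀ m → isEven (suc m) ≡ not (isEven m)
isEven-suc zero          = refl
isEven-suc (suc zero)    = refl
isEven-suc (suc (suc m)) = isEven-suc m

fib-suc-suc : ∀ n → fib (suc (suc n)) ≡ fib n + fib (suc n)
fib-suc-suc n = +-comm (fib (suc n)) (fib n)

mutual
  count-subsetQT-𝔽 : ∀ n → count (subsetQT true {n}) ≡ fib (suc n)
  count-subsetQT-𝔽 zero    = refl
  count-subsetQT-𝔽 (suc n) = begin
    count (subsetQT true {suc n})
      ≡⟨ count-cons {n} (subsetQT true) (subsetQT-∷ true true) (subsetQT-∷ true false) ⟩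
    count (subsetRunQT true 1 {n}) + count (subsetQT true {n})
      ≡⟨ cong₂ _+_ (count-subsetRunQT-𝔽 n 1) (count-subsetQT-𝔽 n) ⟩
    fib n + fib (suc n)
      ≡⟨ fib-suc-suc n ⟨
    fib (suc (suc n)) ∎
    where open ≡-Reasoning

  count-subsetRunQT-𝔽 : ∀ n m → count (subsetRunQT true m {n}) ≡ (if isEven m then fib (suc n) else fib n)
  count-subsetRunQT-𝔽 zero    m with isEven m
  ... | true  = refl
  ... | false = refl
  count-subsetRunQT-𝔽 (suc n) m = begin
    count (subsetRunQT true m {suc n})
      ≡⟨ count-cons {n} (subsetRunQT true m) (subsetRunQT-∷ true m true) (subsetRunQT-∷ true m false) ⟩
    count (subsetRunQT true (suc m) {n}) + count (λ (F : Subset n) → isEven m ∧ subsetQT true F)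
      ≡⟨ cong (_+ count (λ (F : Subset n) → isEven m ∧ subsetQT true F)) (count-subsetRunQT-𝔽 n (suc m)) ⟩
    (if isEven (suc m) then fib (suc n) else fib n) + count (λ (F : Subset n) → isEven m ∧ subsetQT true F)
      ≡⟨ byParity (isEven m) (isEven-suc m) ⟩
    (if isEven m then fib (suc (suc n)) else fib (suc n)) ∎
    where
    open ≡-Reasoning
    byParity : ∀ b → isEven (suc m) ≡ not b →
      (if isEven (suc m) then fib (suc n) else fib n) + count (λ (F : Subset n) → b ∧ subsetQT true F) ≡ (if b then fib (suc (suc n)) else fib (suc n))
    byParity true  even rewrite even = trans (cong (fib n +_) (count-subsetQT-𝔽 n)) (sym (fib-suc-suc n))
    byParity false odd  rewrite odd  = trans (cong (fib (suc n) +_) (length-filterᵇ-false (allSubsets n))) (+-identityʳ _)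

count-subsetRunQT-𝔽¹ : ∀ n m → count (subsetRunQT false m {n}) ≡ fib (suc (suc n))
count-subsetRunQT-𝔽¹ zero    m = refl
count-subsetRunQT-𝔽¹ (suc n) m = begin
  count (subsetRunQT false m {suc n})
    ≡⟨ count-cons {n} (subsetRunQT false m) (subsetRunQT-∷ false m true) (subsetRunQT-∷ false m false) ⟩
  count (subsetRunQT false (suc m) {n}) + count (subsetQT true {n})
    ≡⟨ cong₂ _+_ (count-subsetRunQT-𝔽¹ n (suc m)) (count-subsetQT-𝔽 n) ⟩
  fib (suc (suc (suc n))) ∎
  where open ≡-Reasoning

count-subsetQT-𝔽¹ : ∀ n → count (subsetQT false {n}) ≡ fib (n + 2)
count-subsetQT-𝔽¹ zero    = refl
count-subsetQT-𝔽¹ (suc n) = begin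
  count (subsetQT false {suc n})
    ≡⟨ count-cons {n} (subsetQT false) (subsetQT-∷ false true) (subsetQT-∷ false false) ⟩
  count (subsetRunQT false 1 {n}) + count (subsetQT true {n})
    ≡⟨ cong₂ _+_ (count-subsetRunQT-𝔽¹ n 1) (count-subsetQT-𝔽 n) ⟩
  fib (suc (suc (suc n)))
    ≡⟨ cong (fib ∘ suc) (+-comm 2 n) ⟩
  fib (suc n + 2) ∎
  where open ≡-Reasoning

theorem5p3 : (n : ℕ) → 1 ≤ n → κ (𝔽¹ n) ≡ fib (n + 2)
theorem5p3 n _ = begin
  κ (𝔽¹ n)                    ≡⟨ length-filterᵇ-cong (isQuasiTreeᵇ-𝔽¹ n) (allSubsets n) ⟩
  count (subsetQT false {n})  ≡⟨ count-subsetQT-𝔽¹ n ⟩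
  fib (n + 2)                 ∎
  where open ≡-Reasoning
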